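{- For all nonnegative integers $n$ and $k$, $$\sum_{j=-k}^{k} (-1)^j q^{\frac{j(3j-1)}{2}} \begin{bmatrix} \lfloor \frac{n+j}{2} \rfloor \\ k-j \end{bmatrix} \begin{bmatrix} \lfloor \frac{n-j+1}{2} \rfloor \\ k+j \end{bmatrix} = \begin{bmatrix} n-k \\ k \end{bmatrix}.$$
   Context: $q$ is an indeterminate and $\lfloor x\rfloor$ denotes the largest integer $\le x$. For integers $m$ and $k$, the $q$-binomial coefficient is $\begin{bmatrix} m \\ k \end{bmatrix} = \prod_{i=1}^{k}\frac{1-q^{m-k+i}}{1-q^{i}}$ if $0\le k\le m$, and $\begin{bmatrix} m \\ k \end{bmatrix}=0$ otherwise (in particular it is $0$ when $m<0$). -}

module Defs where

open import Data.Nat as ℕ using (ℕ; zero; suc; _≤?_)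
open import Data.Nat.Divisibility using (_∣?_)
import Data.Nat.DivMod as ℕD
open import Data.Integer as ℤ using (ℤ; +_; -[1+_]; ∣_∣)
open import Data.List using (List; []; _∷_; foldr; map)
open import Data.List.Base using (upTo)
open import Relation.Nullary.Decidable using (does)
open import Data.Bool using (if_then_else_)

-- Formal power series in the indeterminate q with integer coefficients:
-- f N is the coefficient of q^N.  (All objects below are polynomials.)
PS : Set
PS = ℕ → ℤ

0ₚ : PS
0ₚ _ = + 0

qpow : ℕ → PS
qpow e N = if does (N ℕ.≟ e) then + 1 else + 0

_+ₚ_ : PS → PS → PS
(f +ₚ g) N = f N ℤ.+ g N

_·ₚ_ : ℤ → PS → PS
(c ·ₚ f) N = c ℤ.* f N

_*ₚ_ : PS → PS → PS
(f *ₚ g) N = foldr ℤ._+_ (+ 0) (map (λ i → f i ℤ.* g (N ℕ.∸ i)) (upTo (suc N)))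

1ₚ : PS
1ₚ = qpow 0

oneMinusQ : ℕ → PS
oneMinusQ e N = 1ₚ N ℤ.- qpow e N

-- 1/(1 - q^i) for i ≥ 1, as the geometric series Σ_t q^{i t}
invOneMinusQ : ℕ → PS
invOneMinusQ i N = if does (suc i ∣? N) then + 1 else + 0   -- this is 1/(1 - q^(suc i))

-- product over i = 1..k of (1 - q^(m-k+i)) / (1 - q^i), for naturals k ≤ m
qbinomProd : ℕ → ℕ → PS
qbinomProd m k = foldr _*ₚ_ 1ₚ
  (map (λ i → oneMinusQ (m ℕ.∸ k ℕ.+ suc i) *ₚ invOneMinusQ i) (upTo k))

qbinom : ℤ → ℤ → PS
qbinom (+ m) (+ k) = if does (k ≤? m) then qbinomProd m k else 0ₚ
qbinom (+ m) -[1+ _ ] = 0ₚ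
qbinom -[1+ _ ] _ = 0ₚ

floorHalf : ℤ → ℤ
floorHalf (+ m) = + (m ℕD./ 2)
floorHalf -[1+ m ] = -[1+ (m ℕD./ 2) ]

sign : ℤ → ℤ
sign j = if does (2 Data.Nat.Divisibility.∣? ∣ j ∣) then + 1 else ℤ.- (+ 1)

-- j(3j-1)/2 (a nonnegative integer for every integer j)
pent : ℤ → ℕ
pent j = ∣ j ℤ.* (+ 3 ℤ.* j ℤ.- + 1) ∣ ℕD./ 2

sumSym : ℕ → (ℤ → PS) → PS
sumSym k f = foldr _+ₚ_ 0ₚ (map (λ t → f (+ t ℤ.- + k)) (upTo (suc (2 ℕ.* k))))

_≈ₚ_ : PS → PS → Set
f ≈ₚ g = ∀ N → f N ≡ g N
  where open import Relation.Binary.PropositionalEquality using (_≡_)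

LHS : ℕ → ℕ → PS
LHS n k = sumSym k (λ j →
  sign j ·ₚ (qpow (pent j) *ₚ
    (qbinom (floorHalf (+ n ℤ.+ j)) (+ k ℤ.- j) *ₚ
     qbinom (floorHalf (+ n ℤ.- j ℤ.+ + 1)) (+ k ℤ.+ j))))

RHS : ℕ → ℕ → PS
RHS n k = qbinom (+ n ℤ.- + k) (+ k)

-- Both sides F(n,k) satisfy  q^(2k) F(n,k) = q^(2k) F(n-1,k) + q^n F(n-2,k-1)  for n ≥ 2, k ≥ 1,
-- agree for k = 0 and vanish for n < 2k, so they agree because multiplication by q^(2k) is
-- injective.  For the right side the recurrence is the q-Pascal rule.  For the left side let E(j)
-- be the j-th term of the defect of the recurrence.  If n + j = 2a, put b = n - a; the q-Pascal
-- rule, applied to both q-binomials of the three summands of E(j) and of E(j+1), leaves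
--   E(j) = (-1)^j q^(pent j + a + k + j) X   and   E(j+1) = (-1)^(j+1) q^(pent (j+1) + k - j - 1 + b) X
-- with the same X = [a-1, k-j-1] [b-1, k+j].  The exponents agree as pent (j+1) = pent j + 3j + 1,
-- so E(j) + E(j+1) = 0.  Hence E(j) = G(j) - G(j+1) for the restriction G of E to odd n + j, and
-- the defect telescopes to boundary terms, which vanish.

module Submission where

open import Data.Nat as ℕ using (ℕ; zero; suc; s≤s; z≤n)
import Data.Nat.Properties as ℕₚ
open import Data.Nat.Divisibility using (_∣_; _∣?_; ∣⇒≤; ∣m∣n⇒∣m+n; ∣m+n∣m⇒∣n; ∣-refl)
open import Data.Nat.DivMod using (_/_; m/n≡1+[m∸n]/n)
open import Data.Integer as ℤ using (ℤ; +_; -[1+_]; Negative)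
import Data.Integer.Properties as ℤₚ
open import Data.Integer.Tactic.RingSolver using () renaming (solve-∀ to ℤ-solve-∀; solve to ℤ-solve)
open import Data.List using ([]; _∷_; foldr; map)
open import Data.List.Base using (upTo; applyUpTo)
open import Data.List.Properties using (map-applyUpTo)
open import Data.Maybe using (Maybe; just; nothing)
open import Data.Product using (Σ; _,_; _×_)
open import Data.Sum using (_⊎_; inj₁; inj₂)
open import Data.Empty using (⊥-elim)
open import Data.Bool using (if_then_else_)
open import Function using (id; _∘_)
open import Level using (0ℓ)
open import Algebra.Bundles using (CommutativeRing; CommutativeMonoid; RawRing)
open import Algebra.Solver.Ring.AlmostCommutativeRing
  using (AlmostCommutativeRing; fromCommutativeRing; _-Raw-AlmostCommutative⟶_)
open import Relation.Binary.PropositionalEquality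
  using (_≡_; _≢_; refl; sym; trans; cong; cong₂; subst; subst₂; module ≡-Reasoning)
import Relation.Binary.Reasoning.Setoid
open import Relation.Nullary using (Dec; yes; no; does; ¬_)
open import Relation.Nullary.Decidable using (dec-true; dec-false)

open import Defs

foldr-upTo-suc : ∀ {A B : Set} (_⊕_ : A → B → B) e (F : ℕ → A) L →
  foldr _⊕_ e (map F (upTo (suc L))) ≡ F 0 ⊕ foldr _⊕_ e (map (F ∘ suc) (upTo L))
foldr-upTo-suc _⊕_ e F L =
  cong (λ xs → F 0 ⊕ foldr _⊕_ e xs) (trans (map-applyUpTo suc F L) (sym (map-applyUpTo id (F ∘ suc) L)))

module UpTo (M : CommutativeMonoid 0ℓ 0ℓ) where
  open CommutativeMonoid M renaming (refl to ≈-refl; sym to ≈-sym; trans to ≈-trans)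
  open import Relation.Binary.Reasoning.Setoid setoid

  fold : ℕ → (ℕ → Carrier) → Carrier
  fold L F = foldr _∙_ ε (map F (upTo L))

  fold-suc : ∀ L F → fold (suc L) F ≡ F 0 ∙ fold L (F ∘ suc)
  fold-suc L F = foldr-upTo-suc _∙_ ε F L

  fold-cong : ∀ L {F G} → (∀ i → F i ≈ G i) → fold L F ≈ fold L G
  fold-cong zero F≈G = ≈-refl
  fold-cong (suc L) {F} {G} F≈G = begin
    fold (suc L) F        ≡⟨ fold-suc L F ⟩
    F 0 ∙ fold L (F ∘ suc) ≈⟨ ∙-cong (F≈G 0) (fold-cong L (F≈G ∘ suc)) ⟩
    G 0 ∙ fold L (G ∘ suc) ≡⟨ fold-suc L G ⟨
    fold (suc L) G        ∎

  fold-snoc : ∀ L F → fold (suc L) F ≈ fold L F ∙ F L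
  fold-snoc zero F = ≈-trans (identityʳ (F 0)) (≈-sym (identityˡ (F 0)))
  fold-snoc (suc L) F = begin
    fold (suc (suc L)) F               ≡⟨ fold-suc (suc L) F ⟩
    F 0 ∙ fold (suc L) (F ∘ suc)       ≈⟨ ∙-congˡ (fold-snoc L (F ∘ suc)) ⟩
    F 0 ∙ (fold L (F ∘ suc) ∙ F (suc L)) ≈⟨ assoc (F 0) _ _ ⟨
    (F 0 ∙ fold L (F ∘ suc)) ∙ F (suc L) ≡⟨ cong (_∙ F (suc L)) (fold-suc L F) ⟨
    fold (suc L) F ∙ F (suc L)         ∎

  fold-∙ : ∀ L F G → fold L (λ i → F i ∙ G i) ≈ fold L F ∙ fold L G
  fold-∙ zero F G = ≈-sym (identityˡ ε)
  fold-∙ (suc L) F G = begin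
    fold (suc L) (λ i → F i ∙ G i)                         ≡⟨ fold-suc L _ ⟩
    (F 0 ∙ G 0) ∙ fold L (λ i → F (suc i) ∙ G (suc i))     ≈⟨ ∙-congˡ (fold-∙ L (F ∘ suc) (G ∘ suc)) ⟩
    (F 0 ∙ G 0) ∙ (fold L (F ∘ suc) ∙ fold L (G ∘ suc))   ≈⟨ interchange (F 0) (G 0) _ _ ⟩
    (F 0 ∙ fold L (F ∘ suc)) ∙ (G 0 ∙ fold L (G ∘ suc))   ≡⟨ cong₂ _∙_ (fold-suc L F) (fold-suc L G) ⟨
    fold (suc L) F ∙ fold (suc L) G                        ∎
    where open import Algebra.Properties.CommutativeSemigroup commutativeSemigroup using (interchange)

  fold-ε : ∀ L F → (∀ i → F i ≈ ε) → fold L F ≈ ε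
  fold-ε zero F F≈ε = ≈-refl
  fold-ε (suc L) F F≈ε = begin
    fold (suc L) F          ≡⟨ fold-suc L F ⟩
    F 0 ∙ fold L (F ∘ suc)  ≈⟨ ∙-cong (F≈ε 0) (fold-ε L (F ∘ suc) (F≈ε ∘ suc)) ⟩
    ε ∙ ε                   ≈⟨ identityˡ ε ⟩
    ε                       ∎

-- The ring of power series

-- Coefficientwise equality, wrapped in a record so that f and g can be recovered from f ≋ g by
-- unification.
infix 4 _≋_
record _≋_ (f g : PS) : Set where
  constructor coeffwise
  field coeff : f ≈ₚ g
open _≋_

-ₚ_ : PS → PS
(-ₚ f) N = ℤ.- f N

shiftDown : PS → PS
shiftDown f N = f (suc N)

conv : PS → PS → PS
conv f g zero = f 0 ℤ.* g 0
conv f g (suc N) = f 0 ℤ.* g (suc N) ℤ.+ conv (shiftDown f) g N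

*ₚ≗conv : ∀ f g N → (f *ₚ g) N ≡ conv f g N
*ₚ≗conv f g zero = ℤₚ.+-identityʳ _
*ₚ≗conv f g (suc N) =
  trans (foldr-upTo-suc ℤ._+_ (+ 0) (λ i → f i ℤ.* g (suc N ℕ.∸ i)) (suc N))
        (cong (λ x → f 0 ℤ.* g (suc N) ℤ.+ x) (*ₚ≗conv (shiftDown f) g N))

-- Chosen so that constₚ (+ 1) is 1ₚ definitionally.
constₚ : ℤ → PS
constₚ c N = if does (N ℕ.≟ 0) then c else + 0

module CauchyProduct where
  open ≡-Reasoning
  open import Algebra.Properties.CommutativeSemigroup ℤₚ.+-commutativeSemigroup using (interchange)

  conv-cong : ∀ {f f′ g g′} → f ≈ₚ f′ → g ≈ₚ g′ → conv f g ≈ₚ conv f′ g′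
  conv-cong p q zero = cong₂ ℤ._*_ (p 0) (q 0)
  conv-cong p q (suc N) = cong₂ ℤ._+_ (cong₂ ℤ._*_ (p 0) (q (suc N))) (conv-cong (p ∘ suc) q N)

  conv-distribˡ : ∀ f g h → conv f (g +ₚ h) ≈ₚ (conv f g +ₚ conv f h)
  conv-distribˡ f g h zero = ℤₚ.*-distribˡ-+ (f 0) (g 0) (h 0)
  conv-distribˡ f g h (suc N) =
    trans (cong₂ ℤ._+_ (ℤₚ.*-distribˡ-+ (f 0) (g (suc N)) (h (suc N))) (conv-distribˡ (shiftDown f) g h N))
          (interchange (f 0 ℤ.* g (suc N)) (f 0 ℤ.* h (suc N)) _ _)

  conv-distribʳ : ∀ f g h → conv (f +ₚ g) h ≈ₚ (conv f h +ₚ conv g h)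
  conv-distribʳ f g h zero = ℤₚ.*-distribʳ-+ (h 0) (f 0) (g 0)
  conv-distribʳ f g h (suc N) =
    trans (cong₂ ℤ._+_ (ℤₚ.*-distribʳ-+ (h (suc N)) (f 0) (g 0)) (conv-distribʳ (shiftDown f) (shiftDown g) h N))
          (interchange (f 0 ℤ.* h (suc N)) (g 0 ℤ.* h (suc N)) _ _)

  conv-scaleˡ : ∀ c f g → conv (c ·ₚ f) g ≈ₚ (c ·ₚ conv f g)
  conv-scaleˡ c f g zero = ℤₚ.*-assoc c (f 0) (g 0)
  conv-scaleˡ c f g (suc N) =
    trans (cong₂ ℤ._+_ (ℤₚ.*-assoc c (f 0) (g (suc N))) (conv-scaleˡ c (shiftDown f) g N))
          (sym (ℤₚ.*-distribˡ-+ c _ _))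

  conv-zeroˡ : ∀ g → conv 0ₚ g ≈ₚ 0ₚ
  conv-zeroˡ g zero = refl
  conv-zeroˡ g (suc N) = trans (ℤₚ.+-identityˡ _) (conv-zeroˡ g N)

  conv-last : ∀ f g N → conv f g (suc N) ≡ conv f (shiftDown g) N ℤ.+ f (suc N) ℤ.* g 0
  conv-last f g zero = refl
  conv-last f g (suc N) =
    trans (cong (λ x → f 0 ℤ.* g (suc (suc N)) ℤ.+ x) (conv-last (shiftDown f) g N))
          (sym (ℤₚ.+-assoc (f 0 ℤ.* g (suc (suc N))) _ _))

  conv-comm : ∀ f g → conv f g ≈ₚ conv g f
  conv-comm f g zero = ℤₚ.*-comm (f 0) (g 0)
  conv-comm f g (suc N) =
    trans (cong₂ ℤ._+_ (ℤₚ.*-comm (f 0) (g (suc N))) (conv-comm (shiftDown f) g N))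
          (trans (ℤₚ.+-comm (g (suc N) ℤ.* f 0) _) (sym (conv-last g f N)))

  conv-assoc : ∀ f g h → conv (conv f g) h ≈ₚ conv f (conv g h)
  conv-assoc f g h zero = ℤₚ.*-assoc (f 0) (g 0) (h 0)
  conv-assoc f g h (suc N) =
    trans (cong (λ x → (f 0 ℤ.* g 0) ℤ.* h (suc N) ℤ.+ x)
            (trans (conv-distribʳ (f 0 ·ₚ shiftDown g) (conv (shiftDown f) g) h N)
                   (cong₂ ℤ._+_ (conv-scaleˡ (f 0) (shiftDown g) h N) (conv-assoc (shiftDown f) g h N))))
          (regroup (f 0) (g 0) (h (suc N)) _ _)
    where
    regroup : ∀ a b c x y → (a ℤ.* b) ℤ.* c ℤ.+ (a ℤ.* x ℤ.+ y) ≡ a ℤ.* (b ℤ.* c ℤ.+ x) ℤ.+ y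
    regroup = ℤ-solve-∀

  conv-constₚˡ : ∀ c f → conv (constₚ c) f ≈ₚ (c ·ₚ f)
  conv-constₚˡ c f zero = refl
  conv-constₚˡ c f (suc N) =
    trans (cong (λ x → c ℤ.* f (suc N) ℤ.+ x) (conv-zeroˡ f N)) (ℤₚ.+-identityʳ _)

  *ₚ-cong : ∀ {f f′ g g′} → f ≈ₚ f′ → g ≈ₚ g′ → (f *ₚ g) ≈ₚ (f′ *ₚ g′)
  *ₚ-cong {f} {f′} {g} {g′} p q N = begin
    (f *ₚ g) N     ≡⟨ *ₚ≗conv f g N ⟩
    conv f g N     ≡⟨ conv-cong p q N ⟩
    conv f′ g′ N   ≡⟨ *ₚ≗conv f′ g′ N ⟨
    (f′ *ₚ g′) N   ∎

  *ₚ-comm : ∀ f g → (f *ₚ g) ≈ₚ (g *ₚ f)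
  *ₚ-comm f g N = begin
    (f *ₚ g) N   ≡⟨ *ₚ≗conv f g N ⟩
    conv f g N   ≡⟨ conv-comm f g N ⟩
    conv g f N   ≡⟨ *ₚ≗conv g f N ⟨
    (g *ₚ f) N   ∎

  *ₚ-assoc : ∀ f g h → ((f *ₚ g) *ₚ h) ≈ₚ (f *ₚ (g *ₚ h))
  *ₚ-assoc f g h N = begin
    ((f *ₚ g) *ₚ h) N     ≡⟨ *ₚ≗conv (f *ₚ g) h N ⟩
    conv (f *ₚ g) h N     ≡⟨ conv-cong (*ₚ≗conv f g) (λ _ → refl) N ⟩
    conv (conv f g) h N   ≡⟨ conv-assoc f g h N ⟩
    conv f (conv g h) N   ≡⟨ conv-cong (λ _ → refl) (λ M → sym (*ₚ≗conv g h M)) N ⟩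
    conv f (g *ₚ h) N     ≡⟨ *ₚ≗conv f (g *ₚ h) N ⟨
    (f *ₚ (g *ₚ h)) N     ∎

  constₚ-*ₚ : ∀ c f → (constₚ c *ₚ f) ≈ₚ (c ·ₚ f)
  constₚ-*ₚ c f N = trans (*ₚ≗conv (constₚ c) f N) (conv-constₚˡ c f N)

  *ₚ-identityˡ : ∀ f → (1ₚ *ₚ f) ≈ₚ f
  *ₚ-identityˡ f N = trans (constₚ-*ₚ (+ 1) f N) (ℤₚ.*-identityˡ (f N))

  *ₚ-distribʳ : ∀ h f g → ((f +ₚ g) *ₚ h) ≈ₚ ((f *ₚ h) +ₚ (g *ₚ h))
  *ₚ-distribʳ h f g N = begin
    ((f +ₚ g) *ₚ h) N             ≡⟨ *ₚ≗conv (f +ₚ g) h N ⟩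
    conv (f +ₚ g) h N             ≡⟨ conv-distribʳ f g h N ⟩
    conv f h N ℤ.+ conv g h N     ≡⟨ cong₂ ℤ._+_ (*ₚ≗conv f h N) (*ₚ≗conv g h N) ⟨
    (f *ₚ h) N ℤ.+ (g *ₚ h) N     ∎

  *ₚ-distribˡ : ∀ h f g → (h *ₚ (f +ₚ g)) ≈ₚ ((h *ₚ f) +ₚ (h *ₚ g))
  *ₚ-distribˡ h f g N = begin
    (h *ₚ (f +ₚ g)) N             ≡⟨ *ₚ≗conv h (f +ₚ g) N ⟩
    conv h (f +ₚ g) N             ≡⟨ conv-distribˡ h f g N ⟩
    conv h f N ℤ.+ conv h g N     ≡⟨ cong₂ ℤ._+_ (*ₚ≗conv h f N) (*ₚ≗conv h g N) ⟨
    (h *ₚ f) N ℤ.+ (h *ₚ g) N     ∎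

open CauchyProduct

PS-commutativeRing : CommutativeRing 0ℓ 0ℓ
PS-commutativeRing = record
  { Carrier = PS ; _≈_ = _≋_ ; _+_ = _+ₚ_ ; _*_ = _*ₚ_ ; -_ = -ₚ_ ; 0# = 0ₚ ; 1# = 1ₚ
  ; isCommutativeRing = record
    { isRing = record
      { +-isAbelianGroup = record
        { isGroup = record
          { isMonoid = record
            { isSemigroup = record
              { isMagma = record
                { isEquivalence = record
                  { refl = coeffwise λ _ → refl
                  ; sym = λ p → coeffwise λ N → sym (coeff p N)
                  ; trans = λ p q → coeffwise λ N → trans (coeff p N) (coeff q N) }
                ; ∙-cong = λ p q → coeffwise λ N → cong₂ ℤ._+_ (coeff p N) (coeff q N) }
              ; assoc = λ f g h → coeffwise λ N → ℤₚ.+-assoc (f N) (g N) (h N) }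
            ; identity = (λ f → coeffwise λ N → ℤₚ.+-identityˡ (f N))
                       , (λ f → coeffwise λ N → ℤₚ.+-identityʳ (f N)) }
          ; inverse = (λ f → coeffwise λ N → ℤₚ.+-inverseˡ (f N))
                    , (λ f → coeffwise λ N → ℤₚ.+-inverseʳ (f N))
          ; ⁻¹-cong = λ p → coeffwise λ N → cong ℤ.-_ (coeff p N) }
        ; comm = λ f g → coeffwise λ N → ℤₚ.+-comm (f N) (g N) }
      ; *-cong = λ p q → coeffwise (*ₚ-cong (coeff p) (coeff q))
      ; *-assoc = λ f g h → coeffwise (*ₚ-assoc f g h)
      ; *-identity = (λ f → coeffwise (*ₚ-identityˡ f))
                   , (λ f → coeffwise λ N → trans (*ₚ-comm f 1ₚ N) (*ₚ-identityˡ f N))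
      ; distrib = (λ h f g → coeffwise (*ₚ-distribˡ h f g))
                , (λ h f g → coeffwise (*ₚ-distribʳ h f g)) }
    ; *-comm = λ f g → coeffwise (*ₚ-comm f g) } }

open CommutativeRing PS-commutativeRing
  using (+-cong; +-congˡ; +-congʳ; *-cong; *-congˡ; *-congʳ; -‿cong; *-comm; *-assoc
        ; *-identityˡ; *-identityʳ; +-identityˡ; +-identityʳ; zeroˡ; zeroʳ; -‿inverseʳ; distribˡ; distribʳ)
  renaming (refl to ≋-refl; sym to ≋-sym; trans to ≋-trans; reflexive to ≡⇒≋)

module PS-Solver where
  private
    ℤ-rawRing : RawRing 0ℓ 0ℓ
    ℤ-rawRing = record
      { Carrier = ℤ ; _≈_ = _≡_ ; _+_ = ℤ._+_ ; _*_ = ℤ._*_ ; -_ = ℤ.-_ ; 0# = + 0 ; 1# = + 1 }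

    PS-almostCommutativeRing : AlmostCommutativeRing 0ℓ 0ℓ
    PS-almostCommutativeRing = fromCommutativeRing PS-commutativeRing

    constₚ-scale : ∀ a b → (a ·ₚ constₚ b) ≈ₚ constₚ (a ℤ.* b)
    constₚ-scale a b zero = refl
    constₚ-scale a b (suc N) = ℤₚ.*-zeroʳ a

    constₚ-homomorphism : ℤ-rawRing -Raw-AlmostCommutative⟶ PS-almostCommutativeRing
    constₚ-homomorphism = record
      { ⟦_⟧ = constₚ
      ; +-homo = λ a b → coeffwise λ { zero → refl ; (suc N) → refl }
      ; *-homo = λ a b → coeffwise λ N → sym (trans (constₚ-*ₚ a (constₚ b) N) (constₚ-scale a b N))
      ; -‿homo = λ a → coeffwise λ { zero → refl ; (suc N) → refl }
      ; 0-homo = coeffwise λ { zero → refl ; (suc N) → refl }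
      ; 1-homo = ≋-refl }

    constₚ-≟ : ∀ a b → Maybe (constₚ a ≋ constₚ b)
    constₚ-≟ a b with a ℤ.≟ b
    ... | yes refl = just ≋-refl
    ... | no _ = nothing

  open import Algebra.Solver.Ring ℤ-rawRing PS-almostCommutativeRing constₚ-homomorphism constₚ-≟ public
    using (solve; _:=_; _:+_; _:*_; :-_; _:-_; con)

open PS-Solver

module ≋-Reasoning = Relation.Binary.Reasoning.Setoid (CommutativeRing.setoid PS-commutativeRing)

*-vanishʳ : ∀ a {b} → b ≋ 0ₚ → (a *ₚ b) ≋ 0ₚ
*-vanishʳ a b≋0 = ≋-trans (*-congˡ {x = a} b≋0) (zeroʳ a)

*-vanishˡ : ∀ {a} b → a ≋ 0ₚ → (a *ₚ b) ≋ 0ₚ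
*-vanishˡ b a≋0 = ≋-trans (*-congʳ {x = b} a≋0) (zeroˡ b)

·ₚ-vanish : ∀ c {X} → X ≋ 0ₚ → (c ·ₚ X) ≋ 0ₚ
·ₚ-vanish c X≋0 = coeffwise λ M → trans (cong (c ℤ.*_) (coeff X≋0 M)) (ℤₚ.*-zeroʳ c)

vanishing-sum : ∀ {a b c} → a ≋ 0ₚ → b ≋ 0ₚ → c ≋ 0ₚ → a ≋ (b +ₚ c)
vanishing-sum a≋0 b≋0 c≋0 = ≋-trans a≋0 (≋-sym (≋-trans (+-cong b≋0 c≋0) (+-identityʳ 0ₚ)))

constₚ-neg : ∀ c → constₚ (ℤ.- c) ≋ (-ₚ constₚ c)
constₚ-neg c = coeffwise λ { zero → refl ; (suc N) → refl }

difference-vanishes : ∀ {A B C} → (((A +ₚ (-ₚ B)) +ₚ (-ₚ C))) ≋ 0ₚ → A ≋ (B +ₚ C)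
difference-vanishes {A} {B} {C} A-B-C≋0 = begin
  A                                      ≈⟨ solve 3 (λ A B C → A := ((A :- B) :- C) :+ (B :+ C)) ≋-refl A B C ⟩
  ((A +ₚ (-ₚ B)) +ₚ (-ₚ C)) +ₚ (B +ₚ C)  ≈⟨ +-congʳ {x = B +ₚ C} A-B-C≋0 ⟩
  0ₚ +ₚ (B +ₚ C)                         ≈⟨ +-identityˡ (B +ₚ C) ⟩
  B +ₚ C                                 ∎
  where open ≋-Reasoning

-- Monomials and the geometric series

shiftUp : PS → PS
shiftUp f zero = + 0
shiftUp f (suc N) = f N

shiftUp-cong : ∀ {f g} → f ≈ₚ g → shiftUp f ≈ₚ shiftUp g
shiftUp-cong p zero = refl
shiftUp-cong p (suc N) = p N

shiftUp-qpow : ∀ e → shiftUp (qpow e) ≈ₚ qpow (suc e)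
shiftUp-qpow e zero = refl
shiftUp-qpow e (suc N) = refl

qpow-suc-*ₚ : ∀ e f → (qpow (suc e) *ₚ f) ≈ₚ shiftUp (qpow e *ₚ f)
qpow-suc-*ₚ e f zero = *ₚ≗conv (qpow (suc e)) f 0
qpow-suc-*ₚ e f (suc N) =
  trans (*ₚ≗conv (qpow (suc e)) f (suc N)) (trans (ℤₚ.+-identityˡ _) (sym (*ₚ≗conv (qpow e) f N)))

*ₚ-qpow-below : ∀ e f {N} → N ℕ.< e → (qpow e *ₚ f) N ≡ + 0
*ₚ-qpow-below (suc e) f {zero} _ = qpow-suc-*ₚ e f 0
*ₚ-qpow-below (suc e) f {suc N} (s≤s N<e) = trans (qpow-suc-*ₚ e f (suc N)) (*ₚ-qpow-below e f N<e)

*ₚ-qpow-above : ∀ e f M → (qpow e *ₚ f) (M ℕ.+ e) ≡ f M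
*ₚ-qpow-above zero f M = trans (cong (qpow 0 *ₚ f) (ℕₚ.+-identityʳ M)) (*ₚ-identityˡ f M)
*ₚ-qpow-above (suc e) f M = begin
  (qpow (suc e) *ₚ f) (M ℕ.+ suc e)    ≡⟨ cong (qpow (suc e) *ₚ f) (ℕₚ.+-suc M e) ⟩
  (qpow (suc e) *ₚ f) (suc (M ℕ.+ e))  ≡⟨ qpow-suc-*ₚ e f (suc (M ℕ.+ e)) ⟩
  (qpow e *ₚ f) (M ℕ.+ e)              ≡⟨ *ₚ-qpow-above e f M ⟩
  f M                                  ∎
  where open ≡-Reasoning

qpow-+ : ∀ a b → (qpow a *ₚ qpow b) ≋ qpow (a ℕ.+ b)
qpow-+ zero b = *-identityˡ (qpow b)
qpow-+ (suc a) b = coeffwise λ N →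
  trans (qpow-suc-*ₚ a (qpow b) N) (trans (shiftUp-cong (coeff (qpow-+ a b)) N) (shiftUp-qpow (a ℕ.+ b) N))

qpow-cancelˡ : ∀ e {f g} → (qpow e *ₚ f) ≋ (qpow e *ₚ g) → f ≋ g
qpow-cancelˡ e {f} {g} p = coeffwise λ M →
  trans (sym (*ₚ-qpow-above e f M)) (trans (coeff p (M ℕ.+ e)) (*ₚ-qpow-above e g M))

invOneMinusQ-periodic : ∀ i M → invOneMinusQ i (M ℕ.+ suc i) ≡ invOneMinusQ i M
invOneMinusQ-periodic i M = cong (if_then + 1 else + 0) (divisibility-periodic (suc i ∣? M))
  where
  cancel : suc i ∣ M ℕ.+ suc i → suc i ∣ M
  cancel i∣M+i = ∣m+n∣m⇒∣n (subst (suc i ∣_) (ℕₚ.+-comm M (suc i)) i∣M+i) ∣-refl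
  divisibility-periodic : Dec (suc i ∣ M) → does (suc i ∣? (M ℕ.+ suc i)) ≡ does (suc i ∣? M)
  divisibility-periodic (yes i∣M) =
    trans (dec-true (suc i ∣? (M ℕ.+ suc i)) (∣m∣n⇒∣m+n i∣M ∣-refl)) (sym (dec-true (suc i ∣? M) i∣M))
  divisibility-periodic (no i∤M) =
    trans (dec-false (suc i ∣? (M ℕ.+ suc i)) (i∤M ∘ cancel)) (sym (dec-false (suc i ∣? M) i∤M))

geometric-unfold : ∀ i → invOneMinusQ i ≈ₚ ((qpow (suc i) *ₚ invOneMinusQ i) +ₚ 1ₚ)
geometric-unfold i zero = refl
geometric-unfold i (suc N) with suc N ℕ.<? suc i
... | yes N<i = begin
  invOneMinusQ i (suc N)
    ≡⟨ cong (if_then + 1 else + 0) (dec-false (suc i ∣? suc N) (ℕₚ.<⇒≱ N<i ∘ ∣⇒≤)) ⟩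
  + 0
    ≡⟨ cong (ℤ._+ + 0) (*ₚ-qpow-below (suc i) (invOneMinusQ i) N<i) ⟨
  (qpow (suc i) *ₚ invOneMinusQ i) (suc N) ℤ.+ + 0 ∎
  where open ≡-Reasoning
... | no N≮i = subst (λ N → invOneMinusQ i N ≡ ((qpow (suc i) *ₚ invOneMinusQ i) +ₚ 1ₚ) N)
                     (ℕₚ.m∸n+n≡m (ℕₚ.≮⇒≥ N≮i)) (shifted (suc N ℕ.∸ suc i))
  where
  open ≡-Reasoning
  shifted : ∀ M → invOneMinusQ i (M ℕ.+ suc i) ≡ ((qpow (suc i) *ₚ invOneMinusQ i) +ₚ 1ₚ) (M ℕ.+ suc i)
  shifted M = begin
    invOneMinusQ i (M ℕ.+ suc i)   ≡⟨ invOneMinusQ-periodic i M ⟩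
    invOneMinusQ i M               ≡⟨ *ₚ-qpow-above (suc i) (invOneMinusQ i) M ⟨
    (qpow (suc i) *ₚ invOneMinusQ i) (M ℕ.+ suc i)   ≡⟨ ℤₚ.+-identityʳ _ ⟨
    (qpow (suc i) *ₚ invOneMinusQ i) (M ℕ.+ suc i) ℤ.+ + 0
      ≡⟨ cong (λ x → (qpow (suc i) *ₚ invOneMinusQ i) (M ℕ.+ suc i) ℤ.+ x) (cong 1ₚ (ℕₚ.+-suc M i)) ⟨
    ((qpow (suc i) *ₚ invOneMinusQ i) +ₚ 1ₚ) (M ℕ.+ suc i) ∎

oneMinusQ-*-invOneMinusQ : ∀ i → (oneMinusQ (suc i) *ₚ invOneMinusQ i) ≋ 1ₚ
oneMinusQ-*-invOneMinusQ i = begin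
  oneMinusQ (suc i) *ₚ g             ≈⟨ solve 2 (λ q g → (con (+ 1) :- q) :* g := g :- q :* g) ≋-refl Q g ⟩
  g +ₚ (-ₚ (Q *ₚ g))                 ≈⟨ +-congʳ (coeffwise (geometric-unfold i)) ⟩
  ((Q *ₚ g) +ₚ 1ₚ) +ₚ (-ₚ (Q *ₚ g))  ≈⟨ solve 1 (λ x → (x :+ con (+ 1)) :- x := con (+ 1)) ≋-refl (Q *ₚ g) ⟩
  1ₚ                                 ∎
  where
  open ≋-Reasoning
  Q = qpow (suc i)
  g = invOneMinusQ i

qpow-collect : ∀ e₁ e₂ e₃ X Y →
  (qpow e₁ *ₚ ((qpow e₂ *ₚ X) *ₚ (qpow e₃ *ₚ Y))) ≋ (qpow (e₁ ℕ.+ e₂ ℕ.+ e₃) *ₚ (X *ₚ Y))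
qpow-collect e₁ e₂ e₃ X Y = begin
  qpow e₁ *ₚ ((qpow e₂ *ₚ X) *ₚ (qpow e₃ *ₚ Y))
    ≈⟨ solve 5 (λ q₁ q₂ q₃ X Y → q₁ :* ((q₂ :* X) :* (q₃ :* Y)) := ((q₁ :* q₂) :* q₃) :* (X :* Y))
             ≋-refl (qpow e₁) (qpow e₂) (qpow e₃) X Y ⟩
  ((qpow e₁ *ₚ qpow e₂) *ₚ qpow e₃) *ₚ (X *ₚ Y)
    ≈⟨ *-congʳ {x = X *ₚ Y} (≋-trans (*-congʳ {x = qpow e₃} (qpow-+ e₁ e₂)) (qpow-+ (e₁ ℕ.+ e₂) e₃)) ⟩
  qpow (e₁ ℕ.+ e₂ ℕ.+ e₃) *ₚ (X *ₚ Y) ∎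
  where open ≋-Reasoning

-- q-binomial coefficients

open UpTo (CommutativeRing.*-commutativeMonoid PS-commutativeRing)
  using ()
  renaming (fold to infix 30 ∏[<_]_; fold-suc to ∏-suc; fold-cong to ∏-cong; fold-snoc to ∏-snoc; fold-∙ to ∏-*)

qPoch : ℕ → ℕ → PS
qPoch c k = ∏[< k ] λ i → oneMinusQ (c ℕ.+ suc i)

invQFact : ℕ → PS
invQFact k = ∏[< k ] invOneMinusQ

qbinom-above : ∀ {m k} → m ℕ.< k → qbinom (+ m) (+ k) ≋ 0ₚ
qbinom-above {m} {k} m<k = ≡⇒≋ (cong (if_then qbinomProd m k else 0ₚ) (dec-false (k ℕ.≤? m) (ℕₚ.<⇒≱ m<k)))

qbinom-below : ∀ {α ρ} → α ℤ.< ρ → qbinom α ρ ≋ 0ₚ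
qbinom-below { -[1+ _ ]} _ = ≋-refl
qbinom-below {+ a} {+ r} (ℤ.+<+ a<r) = qbinom-above a<r
qbinom-below {+ a} { -[1+ _ ]} _ = ≋-refl

qbinom-qPoch : ∀ c k → qbinom (+ (c ℕ.+ k)) (+ k) ≋ (qPoch c k *ₚ invQFact k)
qbinom-qPoch c k = begin
  qbinom (+ (c ℕ.+ k)) (+ k)
    ≡⟨ cong (if_then qbinomProd (c ℕ.+ k) k else 0ₚ) (dec-true (k ℕ.≤? c ℕ.+ k) (ℕₚ.m≤n+m k c)) ⟩
  ∏[< k ] (λ i → oneMinusQ (c ℕ.+ k ℕ.∸ k ℕ.+ suc i) *ₚ invOneMinusQ i)
    ≡⟨ cong (λ d → ∏[< k ] (λ i → oneMinusQ (d ℕ.+ suc i) *ₚ invOneMinusQ i)) (ℕₚ.m+n∸n≡m c k) ⟩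
  ∏[< k ] (λ i → oneMinusQ (c ℕ.+ suc i) *ₚ invOneMinusQ i)
    ≈⟨ ∏-* k (λ i → oneMinusQ (c ℕ.+ suc i)) invOneMinusQ ⟩
  qPoch c k *ₚ invQFact k ∎
  where open ≋-Reasoning

oneMinusQ-zero : oneMinusQ 0 ≋ 0ₚ
oneMinusQ-zero = coeffwise λ N → ℤₚ.+-inverseʳ (1ₚ N)

qPoch-suc : ∀ c k → qPoch c (suc k) ≋ (oneMinusQ (suc c) *ₚ qPoch (suc c) k)
qPoch-suc c k = ≋-trans (≡⇒≋ (∏-suc k (λ i → oneMinusQ (c ℕ.+ suc i))))
  (*-cong (≡⇒≋ (cong oneMinusQ (ℕₚ.+-comm c 1)))
          (∏-cong k λ i → ≡⇒≋ (cong oneMinusQ (ℕₚ.+-suc c (suc i)))))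

qbinom-qPoch-pred : ∀ c k → qbinom (+ (c ℕ.+ k)) (+ suc k) ≋ ((oneMinusQ c *ₚ qPoch c k) *ₚ invQFact (suc k))
qbinom-qPoch-pred zero k = begin
  qbinom (+ k) (+ suc k)                          ≈⟨ qbinom-above (ℕₚ.n<1+n k) ⟩
  0ₚ                                              ≈⟨ zeroˡ (qPoch 0 k *ₚ invQFact (suc k)) ⟨
  0ₚ *ₚ (qPoch 0 k *ₚ invQFact (suc k))           ≈⟨ *-congʳ {x = qPoch 0 k *ₚ invQFact (suc k)} oneMinusQ-zero ⟨
  oneMinusQ 0 *ₚ (qPoch 0 k *ₚ invQFact (suc k))  ≈⟨ *-assoc (oneMinusQ 0) (qPoch 0 k) (invQFact (suc k)) ⟨
  (oneMinusQ 0 *ₚ qPoch 0 k) *ₚ invQFact (suc k)  ∎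
  where open ≋-Reasoning
qbinom-qPoch-pred (suc c) k = begin
  qbinom (+ suc (c ℕ.+ k)) (+ suc k)   ≡⟨ cong (λ m → qbinom (+ m) (+ suc k)) (ℕₚ.+-suc c k) ⟨
  qbinom (+ (c ℕ.+ suc k)) (+ suc k)   ≈⟨ qbinom-qPoch c (suc k) ⟩
  qPoch c (suc k) *ₚ invQFact (suc k)  ≈⟨ *-congʳ {x = invQFact (suc k)} (qPoch-suc c k) ⟩
  (oneMinusQ (suc c) *ₚ qPoch (suc c) k) *ₚ invQFact (suc k) ∎
  where open ≋-Reasoning

qbinom-pascal-qPoch : ∀ c k →
  (qpow (suc k) *ₚ qbinom (+ suc (c ℕ.+ k)) (+ suc k)) ≋
  ((qpow (suc k) *ₚ qbinom (+ (c ℕ.+ k)) (+ suc k)) +ₚ (qpow (suc (c ℕ.+ k)) *ₚ qbinom (+ (c ℕ.+ k)) (+ k)))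
qbinom-pascal-qPoch c k = begin
  Q *ₚ qbinom (+ suc (c ℕ.+ k)) (+ suc k)
    ≡⟨ cong (λ m → Q *ₚ qbinom (+ m) (+ suc k)) (ℕₚ.+-suc c k) ⟨
  Q *ₚ qbinom (+ (c ℕ.+ suc k)) (+ suc k)
    ≈⟨ *-congˡ {x = Q} (qbinom-qPoch c (suc k)) ⟩
  Q *ₚ (qPoch c (suc k) *ₚ invQFact (suc k))
    ≈⟨ *-congˡ {x = Q} (*-cong (∏-snoc k (λ i → oneMinusQ (c ℕ.+ suc i))) (∏-snoc k invOneMinusQ)) ⟩
  Q *ₚ ((P *ₚ oneMinusQ (c ℕ.+ suc k)) *ₚ (I *ₚ Iₖ))
    ≈⟨ *-congˡ {x = Q} (*-congʳ {x = I *ₚ Iₖ} (*-congˡ {x = P} (+-congˡ {x = 1ₚ} (-‿cong q^[c+k+1])))) ⟩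
  Q *ₚ ((P *ₚ (1ₚ +ₚ (-ₚ (Q *ₚ C)))) *ₚ (I *ₚ Iₖ))
    ≈⟨ solve 5 (λ Q C P I Iₖ →
                 Q :* ((P :* (con (+ 1) :- Q :* C)) :* (I :* Iₖ))
                 := Q :* (((con (+ 1) :- C) :* P) :* (I :* Iₖ))
                    :+ ((Q :* C) :* (P :* I)) :* ((con (+ 1) :- Q) :* Iₖ))
               ≋-refl Q C P I Iₖ ⟩
  (Q *ₚ ((oneMinusQ c *ₚ P) *ₚ (I *ₚ Iₖ))) +ₚ (((Q *ₚ C) *ₚ (P *ₚ I)) *ₚ (oneMinusQ (suc k) *ₚ Iₖ))
    ≈⟨ +-congˡ {x = Q *ₚ ((oneMinusQ c *ₚ P) *ₚ (I *ₚ Iₖ))}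
               (*-congˡ {x = (Q *ₚ C) *ₚ (P *ₚ I)} (oneMinusQ-*-invOneMinusQ k)) ⟩
  (Q *ₚ ((oneMinusQ c *ₚ P) *ₚ (I *ₚ Iₖ))) +ₚ (((Q *ₚ C) *ₚ (P *ₚ I)) *ₚ 1ₚ)
    ≈⟨ +-cong (*-congˡ {x = Q} (*-congˡ {x = oneMinusQ c *ₚ P} (∏-snoc k invOneMinusQ)))
              (≋-sym (*-identityʳ ((Q *ₚ C) *ₚ (P *ₚ I)))) ⟨
  (Q *ₚ ((oneMinusQ c *ₚ P) *ₚ invQFact (suc k))) +ₚ ((Q *ₚ C) *ₚ (P *ₚ I))
    ≈⟨ +-cong (*-congˡ {x = Q} (qbinom-qPoch-pred c k))
              (*-cong (≋-trans (≡⇒≋ (cong qpow (sym (ℕₚ.+-suc c k)))) q^[c+k+1]) (qbinom-qPoch c k)) ⟨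
  (Q *ₚ qbinom (+ (c ℕ.+ k)) (+ suc k)) +ₚ (qpow (suc (c ℕ.+ k)) *ₚ qbinom (+ (c ℕ.+ k)) (+ k))
    ∎
  where
  open ≋-Reasoning
  Q = qpow (suc k)
  C = qpow c
  P = qPoch c k
  I = invQFact k
  Iₖ = invOneMinusQ k
  q^[c+k+1] : qpow (c ℕ.+ suc k) ≋ (Q *ₚ C)
  q^[c+k+1] = ≋-sym (≋-trans (qpow-+ (suc k) c) (≡⇒≋ (cong qpow (ℕₚ.+-comm (suc k) c))))

qbinom-pascalℕ : ∀ m k →
  (qpow (suc k) *ₚ qbinom (+ suc m) (+ suc k)) ≋
  ((qpow (suc k) *ₚ qbinom (+ m) (+ suc k)) +ₚ (qpow (suc m) *ₚ qbinom (+ m) (+ k)))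
qbinom-pascalℕ m k with k ℕ.≤? m
... | yes k≤m = subst (λ m → (qpow (suc k) *ₚ qbinom (+ suc m) (+ suc k)) ≋
                             ((qpow (suc k) *ₚ qbinom (+ m) (+ suc k)) +ₚ (qpow (suc m) *ₚ qbinom (+ m) (+ k))))
                      (ℕₚ.m∸n+n≡m k≤m) (qbinom-pascal-qPoch (m ℕ.∸ k) k)
... | no k≰m = vanishing-sum (*-vanishʳ (qpow (suc k)) (qbinom-above (s≤s m<k)))
                             (*-vanishʳ (qpow (suc k)) (qbinom-above (ℕₚ.m<n⇒m<1+n m<k)))
                             (*-vanishʳ (qpow (suc m)) (qbinom-above m<k))
  where m<k = ℕₚ.≰⇒> k≰m

-- q^x for an integer exponent.  Negative exponents give 0; below they only
-- ever multiply q-binomial coefficients that vanish anyway.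
qpowℤ : ℤ → PS
qpowℤ (+ e) = qpow e
qpowℤ -[1+ _ ] = 0ₚ

-- The q-Pascal rule [α, ρ] = [α-1, ρ] + q^(α-ρ) [α-1, ρ-1] multiplied by q^ρ; in this form it
-- holds for all integer indices except α = ρ = 0.
qbinom-pascal : ∀ α ρ → ¬ (α ≡ + 0 × ρ ≡ + 0) →
  (qpowℤ ρ *ₚ qbinom α ρ) ≋
  ((qpowℤ ρ *ₚ qbinom (α ℤ.- + 1) ρ) +ₚ (qpowℤ α *ₚ qbinom (α ℤ.- + 1) (ρ ℤ.- + 1)))
qbinom-pascal -[1+ a ] ρ _ = vanishing-sum (zeroʳ (qpowℤ ρ)) (zeroʳ (qpowℤ ρ)) (zeroˡ 0ₚ)
qbinom-pascal (+ 0) (+ 0) not00 = ⊥-elim (not00 (refl , refl))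
qbinom-pascal (+ 0) (+ suc r) _ =
  vanishing-sum (*-vanishʳ (qpow (suc r)) (qbinom-above {0} {suc r} (s≤s z≤n))) (zeroʳ (qpow (suc r))) (zeroʳ 1ₚ)
qbinom-pascal (+ 0) -[1+ r ] _ = vanishing-sum (zeroˡ 0ₚ) (zeroˡ 0ₚ) (zeroʳ 1ₚ)
qbinom-pascal (+ suc m) (+ 0) _ =
  ≋-sym (≋-trans (+-congˡ {x = 1ₚ *ₚ 1ₚ} (zeroʳ (qpow (suc m)))) (+-identityʳ (1ₚ *ₚ 1ₚ)))
qbinom-pascal (+ suc m) (+ suc k) _ = qbinom-pascalℕ m k
qbinom-pascal (+ suc m) -[1+ r ] _ = vanishing-sum (zeroˡ 0ₚ) (zeroˡ 0ₚ) (zeroʳ (qpow (suc m)))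

pascal-nondegenerate : ∀ α ρ x → α ℤ.+ α ℤ.+ ρ ≡ + suc x → ¬ (α ≡ + 0 × ρ ≡ + 0)
pascal-nondegenerate _ _ x eq (refl , refl) with ℤₚ.+-injective eq
... | ()

qbinom-negʳ : ∀ α {ρ} → Negative ρ → qbinom α ρ ≋ 0ₚ
qbinom-negʳ (+ _) { -[1+ _ ]} _ = ≋-refl
qbinom-negʳ -[1+ _ ] _ = ≋-refl

qbinom-pred-negˡ : ∀ {α} ρ → Negative α → qbinom (α ℤ.- + 1) ρ ≋ 0ₚ
qbinom-pred-negˡ { -[1+ _ ]} ρ _ = ≋-refl

QBinomView : ℤ → ℤ → Set
QBinomView α ρ = qbinom α ρ ≋ 0ₚ ⊎ (Σ ℕ λ m → Σ ℕ λ k → α ≡ + m × ρ ≡ + k)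

qbinom-view : ∀ α ρ → QBinomView α ρ
qbinom-view (+ m) (+ k) = inj₂ (m , k , refl , refl)
qbinom-view (+ m) -[1+ _ ] = inj₁ ≋-refl
qbinom-view -[1+ _ ] ρ = inj₁ ≋-refl

qpowℤ-split : ∀ x y {X Y} → (Negative x → X ≋ 0ₚ) → (Negative y → Y ≋ 0ₚ) →
  (qpowℤ (x ℤ.+ y) *ₚ (X *ₚ Y)) ≋ ((qpowℤ x *ₚ X) *ₚ (qpowℤ y *ₚ Y))
qpowℤ-split -[1+ u ] y {X} {Y} X≋0 _ =
  ≋-trans (*-vanishʳ (qpowℤ (-[1+ u ] ℤ.+ y)) (*-vanishˡ Y (X≋0 ℤ.neg)))
          (≋-sym (*-vanishˡ (qpowℤ y *ₚ Y) (zeroˡ X)))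
qpowℤ-split (+ u) -[1+ v ] {X} {Y} _ Y≋0 =
  ≋-trans (*-vanishʳ (qpowℤ (+ u ℤ.+ -[1+ v ])) (*-vanishʳ X (Y≋0 ℤ.neg)))
          (≋-sym (*-vanishʳ (qpow u *ₚ X) (zeroˡ Y)))
qpowℤ-split (+ u) (+ v) {X} {Y} _ _ = begin
  qpow (u ℕ.+ v) *ₚ (X *ₚ Y)           ≈⟨ *-congʳ {x = X *ₚ Y} (qpow-+ u v) ⟨
  (qpow u *ₚ qpow v) *ₚ (X *ₚ Y)
    ≈⟨ solve 4 (λ a b x y → (a :* b) :* (x :* y) := (a :* x) :* (b :* y)) ≋-refl (qpow u) (qpow v) X Y ⟩
  (qpow u *ₚ X) *ₚ (qpow v *ₚ Y)       ∎
  where open ≋-Reasoning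

qpow-qpowℤ-absorb : ∀ e α {X} → (Negative α → X ≋ 0ₚ) → (qpow e *ₚ (qpowℤ α *ₚ X)) ≋ (qpowℤ (+ e ℤ.+ α) *ₚ X)
qpow-qpowℤ-absorb e (+ a) {X} _ = ≋-trans (≋-sym (*-assoc (qpow e) (qpow a) X)) (*-congʳ {x = X} (qpow-+ e a))
qpow-qpowℤ-absorb e -[1+ u ] {X} X≋0 =
  ≋-trans (*-vanishʳ (qpow e) (zeroˡ X)) (≋-sym (*-vanishʳ (qpowℤ (+ e ℤ.+ -[1+ u ])) (X≋0 ℤ.neg)))

pascal-difference₁ : ∀ {U V} X Y Z W → U ≋ (X +ₚ Z) → V ≋ (Y +ₚ W) →
  (((U *ₚ V) +ₚ (-ₚ (X *ₚ V))) +ₚ (-ₚ (Z *ₚ W))) ≋ (Z *ₚ Y)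
pascal-difference₁ {U} {V} X Y Z W U≋X+Z V≋Y+W = begin
  ((U *ₚ V) +ₚ (-ₚ (X *ₚ V))) +ₚ (-ₚ (Z *ₚ W))
    ≈⟨ +-congʳ {x = -ₚ (Z *ₚ W)} (+-cong (*-cong U≋X+Z V≋Y+W) (-‿cong (*-congˡ {x = X} V≋Y+W))) ⟩
  (((X +ₚ Z) *ₚ (Y +ₚ W)) +ₚ (-ₚ (X *ₚ (Y +ₚ W)))) +ₚ (-ₚ (Z *ₚ W))
    ≈⟨ solve 4 (λ X Y Z W → (((X :+ Z) :* (Y :+ W)) :- (X :* (Y :+ W))) :- (Z :* W) := Z :* Y) ≋-refl X Y Z W ⟩
  Z *ₚ Y ∎
  where open ≋-Reasoning

pascal-difference₂ : ∀ {U V} X Y Z W → U ≋ (X +ₚ Z) → V ≋ (Y +ₚ W) →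
  (((U *ₚ V) +ₚ (-ₚ (U *ₚ Y))) +ₚ (-ₚ (Z *ₚ W))) ≋ (X *ₚ W)
pascal-difference₂ {U} {V} X Y Z W U≋X+Z V≋Y+W = begin
  ((U *ₚ V) +ₚ (-ₚ (U *ₚ Y))) +ₚ (-ₚ (Z *ₚ W))
    ≈⟨ +-congʳ {x = -ₚ (Z *ₚ W)} (+-cong (*-cong U≋X+Z V≋Y+W) (-‿cong (*-congʳ {x = Y} U≋X+Z))) ⟩
  (((X +ₚ Z) *ₚ (Y +ₚ W)) +ₚ (-ₚ ((X +ₚ Z) *ₚ Y))) +ₚ (-ₚ (Z *ₚ W))
    ≈⟨ solve 4 (λ X Y Z W → (((X :+ Z) :* (Y :+ W)) :- ((X :+ Z) :* Y)) :- (Z :* W) := X :* W) ≋-refl X Y Z W ⟩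
  X *ₚ W ∎
  where open ≋-Reasoning

half-double : ∀ x → (x ℕ.+ x) / 2 ≡ x
half-double zero = refl
half-double (suc x) = begin
  (suc x ℕ.+ suc x) / 2        ≡⟨ cong (λ y → suc y / 2) (ℕₚ.+-suc x x) ⟩
  suc (suc (x ℕ.+ x)) / 2      ≡⟨ m/n≡1+[m∸n]/n {suc (suc (x ℕ.+ x))} {2} (s≤s (s≤s z≤n)) ⟩
  suc ((x ℕ.+ x) / 2)          ≡⟨ cong suc (half-double x) ⟩
  suc x                        ∎
  where open ≡-Reasoning

half-suc-double : ∀ x → suc (x ℕ.+ x) / 2 ≡ x
half-suc-double zero = refl
half-suc-double (suc x) = begin
  suc (suc x ℕ.+ suc x) / 2    ≡⟨ cong (λ y → suc (suc y) / 2) (ℕₚ.+-suc x x) ⟩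
  suc (suc (suc (x ℕ.+ x))) / 2 ≡⟨ m/n≡1+[m∸n]/n {suc (suc (suc (x ℕ.+ x)))} {2} (s≤s (s≤s z≤n)) ⟩
  suc (suc (x ℕ.+ x) / 2)      ≡⟨ cong suc (half-suc-double x) ⟩
  suc x                        ∎
  where open ≡-Reasoning

floorHalf-double : ∀ h → floorHalf (h ℤ.+ h) ≡ h
floorHalf-double (+ x) = cong +_ (half-double x)
floorHalf-double -[1+ x ] = cong -[1+_] (half-suc-double x)

floorHalf-double+1 : ∀ h → floorHalf (h ℤ.+ h ℤ.+ + 1) ≡ h
floorHalf-double+1 (+ x) = cong +_ (trans (cong (_/ 2) (ℕₚ.+-comm (x ℕ.+ x) 1)) (half-suc-double x))
floorHalf-double+1 -[1+ x ] = cong -[1+_] (half-double x)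

floorHalf-even : ∀ {x} h → x ≡ h ℤ.+ h → floorHalf x ≡ h
floorHalf-even h refl = floorHalf-double h

floorHalf-odd : ∀ {x} h → x ≡ h ℤ.+ h ℤ.+ + 1 → floorHalf x ≡ h
floorHalf-odd h refl = floorHalf-double+1 h

Parity : ℤ → Set
Parity x = (Σ ℤ λ h → x ≡ h ℤ.+ h) ⊎ (Σ ℤ λ h → x ≡ h ℤ.+ h ℤ.+ + 1)

parityℕ : ∀ x → (Σ ℕ λ h → x ≡ h ℕ.+ h) ⊎ (Σ ℕ λ h → x ≡ suc (h ℕ.+ h))
parityℕ zero = inj₁ (0 , refl)
parityℕ (suc x) with parityℕ x
... | inj₁ (h , x≡2h) = inj₂ (h , cong suc x≡2h)
... | inj₂ (h , x≡2h+1) = inj₁ (suc h , cong suc (trans x≡2h+1 (sym (ℕₚ.+-suc h h))))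

parity : ∀ x → Parity x
parity (+ x) with parityℕ x
... | inj₁ (h , refl) = inj₁ (+ h , refl)
... | inj₂ (h , refl) = inj₂ (+ h , cong +_ (ℕₚ.+-comm 1 (h ℕ.+ h)))
parity -[1+ x ] with parityℕ x
... | inj₁ (h , refl) = inj₂ (-[1+ h ] , refl)
... | inj₂ (h , refl) = inj₁ (-[1+ h ] , refl)

even≢odd : ∀ h h′ → h ℤ.+ h ≢ h′ ℤ.+ h′ ℤ.+ + 1
even≢odd h h′ eq with trans (sym (floorHalf-double h)) (floorHalf-odd h′ eq)
... | refl = ℤₚ.i≢suc[i] (trans eq (ℤₚ.+-comm (h ℤ.+ h) (+ 1)))

floorHalf-complement : ∀ N j → floorHalf (N ℤ.+ j) ℤ.+ floorHalf (N ℤ.- j ℤ.+ + 1) ≡ N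
floorHalf-complement N j with parity (N ℤ.+ j)
... | inj₁ (h , N+j≡2h) = begin
  floorHalf (N ℤ.+ j) ℤ.+ floorHalf (N ℤ.- j ℤ.+ + 1)
    ≡⟨ cong₂ ℤ._+_ (floorHalf-even h N+j≡2h) (floorHalf-odd (N ℤ.- h) (begin
         N ℤ.- j ℤ.+ + 1                        ≡⟨ ℤ-solve (N ∷ j ∷ []) ⟩
         N ℤ.- ((N ℤ.+ j) ℤ.- N) ℤ.+ + 1        ≡⟨ cong (λ x → N ℤ.- (x ℤ.- N) ℤ.+ + 1) N+j≡2h ⟩
         N ℤ.- ((h ℤ.+ h) ℤ.- N) ℤ.+ + 1        ≡⟨ ℤ-solve (N ∷ h ∷ []) ⟩
         (N ℤ.- h) ℤ.+ (N ℤ.- h) ℤ.+ + 1        ∎)) ⟩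
  h ℤ.+ (N ℤ.- h)
    ≡⟨ ℤ-solve (N ∷ h ∷ []) ⟩
  N ∎
  where open ≡-Reasoning
... | inj₂ (h , N+j≡2h+1) = begin
  floorHalf (N ℤ.+ j) ℤ.+ floorHalf (N ℤ.- j ℤ.+ + 1)
    ≡⟨ cong₂ ℤ._+_ (floorHalf-odd h N+j≡2h+1) (floorHalf-even (N ℤ.- h) (begin
         N ℤ.- j ℤ.+ + 1                               ≡⟨ ℤ-solve (N ∷ j ∷ []) ⟩
         N ℤ.- ((N ℤ.+ j) ℤ.- N) ℤ.+ + 1               ≡⟨ cong (λ x → N ℤ.- (x ℤ.- N) ℤ.+ + 1) N+j≡2h+1 ⟩
         N ℤ.- ((h ℤ.+ h ℤ.+ + 1) ℤ.- N) ℤ.+ + 1       ≡⟨ ℤ-solve (N ∷ h ∷ []) ⟩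
         (N ℤ.- h) ℤ.+ (N ℤ.- h)                       ∎)) ⟩
  h ℤ.+ (N ℤ.- h)
    ≡⟨ ℤ-solve (N ∷ h ∷ []) ⟩
  N ∎
  where open ≡-Reasoning

halves-difference : ∀ N j h → N ℤ.+ j ≡ h ℤ.+ h → h ℤ.- (N ℤ.- h) ≡ j
halves-difference N j h N+j≡2h = begin
  h ℤ.- (N ℤ.- h)    ≡⟨ ℤ-solve (N ∷ h ∷ []) ⟩
  h ℤ.+ h ℤ.- N      ≡⟨ cong (ℤ._- N) N+j≡2h ⟨
  N ℤ.+ j ℤ.- N      ≡⟨ ℤ-solve (N ∷ j ∷ []) ⟩
  j                  ∎
  where open ≡-Reasoning

pred≡⇒≡suc : ∀ x {m} → x ℤ.- + 1 ≡ + m → x ≡ + suc m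
pred≡⇒≡suc x {m} x-1≡m = begin
  x                ≡⟨ ℤ-solve (x ∷ []) ⟩
  x ℤ.- + 1 ℤ.+ + 1 ≡⟨ cong (ℤ._+ + 1) x-1≡m ⟩
  + (m ℕ.+ 1)      ≡⟨ cong +_ (ℕₚ.+-comm m 1) ⟩
  + suc m          ∎
  where open ≡-Reasoning

[1+t]-[1+c]≡t-c : ∀ t c → + suc t ℤ.- + suc c ≡ + t ℤ.- + c
[1+t]-[1+c]≡t-c t c = shift (+ t) (+ c)
  where
  shift : ∀ T C → (+ 1 ℤ.+ T) ℤ.- (+ 1 ℤ.+ C) ≡ T ℤ.- C
  shift = ℤ-solve-∀

[1+2c]-c≡1+c : ∀ c → + suc (2 ℕ.* c) ℤ.- + c ≡ + suc c
[1+2c]-c≡1+c c = trans (cong (λ x → (+ 1 ℤ.+ x) ℤ.- + c) 2c≡c+c) (shift (+ c))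
  where
  2c≡c+c : + (2 ℕ.* c) ≡ + c ℤ.+ + c
  2c≡c+c = trans (cong (λ x → + (c ℕ.+ x)) (ℕₚ.+-identityʳ c)) (ℤₚ.pos-+ c c)
  shift : ∀ C → (+ 1 ℤ.+ (C ℤ.+ C)) ℤ.- C ≡ + 1 ℤ.+ C
  shift = ℤ-solve-∀

m+-[1+m+d]≡-[1+d] : ∀ m d → + m ℤ.+ -[1+ m ℕ.+ d ] ≡ -[1+ d ]
m+-[1+m+d]≡-[1+d] m d = trans (cong (λ x → + m ℤ.+ ℤ.- (+ 1 ℤ.+ x)) (ℤₚ.pos-+ m d)) (cancel (+ m) (+ d))
  where
  cancel : ∀ M D → M ℤ.+ ℤ.- (+ 1 ℤ.+ (M ℤ.+ D)) ≡ ℤ.- (+ 1 ℤ.+ D)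
  cancel = ℤ-solve-∀

negative-gap : ∀ {K m} → K ℕ.≤ m → Negative (+ K ℤ.+ -[1+ m ])
negative-gap {K} K≤m with ℕₚ.m≤n⇒∃[o]m+o≡n K≤m
... | d , refl = subst Negative (sym (m+-[1+m+d]≡-[1+d] K d)) ℤ.neg

sign-+-suc : ∀ x → sign (+ suc x) ≡ ℤ.- sign (+ x)
sign-+-suc zero = refl
sign-+-suc (suc x) = trans (sym (ℤₚ.neg-involutive (sign (+ x)))) (cong ℤ.-_ (sym (sign-+-suc x)))

sign-suc : ∀ j → sign (j ℤ.+ + 1) ≡ ℤ.- sign j
sign-suc (+ x) = trans (cong (sign ∘ +_) (ℕₚ.+-comm x 1)) (sign-+-suc x)
sign-suc -[1+ zero ] = refl
sign-suc -[1+ suc y ] = sign-+-suc y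

pentagonal : ℕ → ℕ
pentagonal zero = 0
pentagonal (suc x) = pentagonal x ℕ.+ suc (3 ℕ.* x)

pentagonal-double : ∀ x → + pentagonal x ℤ.+ + pentagonal x ≡ + x ℤ.* (+ 3 ℤ.* + x ℤ.- + 1)
pentagonal-double zero = refl
pentagonal-double (suc x) = begin
  + (P ℕ.+ suc (3 ℕ.* x)) ℤ.+ + (P ℕ.+ suc (3 ℕ.* x))
    ≡⟨ cong₂ ℤ._+_ (ℤₚ.pos-+ P (suc (3 ℕ.* x))) (ℤₚ.pos-+ P (suc (3 ℕ.* x))) ⟩
  (+ P ℤ.+ (+ 1 ℤ.+ + (3 ℕ.* x))) ℤ.+ (+ P ℤ.+ (+ 1 ℤ.+ + (3 ℕ.* x)))
    ≡⟨ cong (λ y → (+ P ℤ.+ (+ 1 ℤ.+ y)) ℤ.+ (+ P ℤ.+ (+ 1 ℤ.+ y))) (ℤₚ.pos-* 3 x) ⟩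
  (+ P ℤ.+ (+ 1 ℤ.+ + 3 ℤ.* + x)) ℤ.+ (+ P ℤ.+ (+ 1 ℤ.+ + 3 ℤ.* + x))
    ≡⟨ regroup (+ P) (+ x) ⟩
  (+ P ℤ.+ + P) ℤ.+ (+ 2 ℤ.+ + 6 ℤ.* + x)
    ≡⟨ cong (ℤ._+ (+ 2 ℤ.+ + 6 ℤ.* + x)) (pentagonal-double x) ⟩
  + x ℤ.* (+ 3 ℤ.* + x ℤ.- + 1) ℤ.+ (+ 2 ℤ.+ + 6 ℤ.* + x)
    ≡⟨ step (+ x) ⟩
  (+ 1 ℤ.+ + x) ℤ.* (+ 3 ℤ.* (+ 1 ℤ.+ + x) ℤ.- + 1) ∎
  where
  open ≡-Reasoning
  P = pentagonal x
  regroup : ∀ P X → (P ℤ.+ (+ 1 ℤ.+ + 3 ℤ.* X)) ℤ.+ (P ℤ.+ (+ 1 ℤ.+ + 3 ℤ.* X)) ≡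
                    (P ℤ.+ P) ℤ.+ (+ 2 ℤ.+ + 6 ℤ.* X)
  regroup = ℤ-solve-∀
  step : ∀ X → X ℤ.* (+ 3 ℤ.* X ℤ.- + 1) ℤ.+ (+ 2 ℤ.+ + 6 ℤ.* X) ≡
               (+ 1 ℤ.+ X) ℤ.* (+ 3 ℤ.* (+ 1 ℤ.+ X) ℤ.- + 1)
  step = ℤ-solve-∀

pentWitness : ℤ → ℕ
pentWitness (+ x) = pentagonal x
pentWitness -[1+ x ] = pentagonal (suc x) ℕ.+ suc x

pentWitness-double : ∀ j → + pentWitness j ℤ.+ + pentWitness j ≡ j ℤ.* (+ 3 ℤ.* j ℤ.- + 1)
pentWitness-double (+ x) = pentagonal-double x
pentWitness-double -[1+ x ] = begin
  + (P ℕ.+ suc x) ℤ.+ + (P ℕ.+ suc x)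
    ≡⟨ cong₂ ℤ._+_ (ℤₚ.pos-+ P (suc x)) (ℤₚ.pos-+ P (suc x)) ⟩
  (+ P ℤ.+ + suc x) ℤ.+ (+ P ℤ.+ + suc x)
    ≡⟨ regroup (+ P) (+ suc x) ⟩
  (+ P ℤ.+ + P) ℤ.+ (+ suc x ℤ.+ + suc x)
    ≡⟨ cong (ℤ._+ (+ suc x ℤ.+ + suc x)) (pentagonal-double (suc x)) ⟩
  + suc x ℤ.* (+ 3 ℤ.* + suc x ℤ.- + 1) ℤ.+ (+ suc x ℤ.+ + suc x)
    ≡⟨ step (+ suc x) ⟩
  ℤ.- + suc x ℤ.* (+ 3 ℤ.* ℤ.- + suc x ℤ.- + 1) ∎
  where
  open ≡-Reasoning
  P = pentagonal (suc x)
  regroup : ∀ P Y → (P ℤ.+ Y) ℤ.+ (P ℤ.+ Y) ≡ (P ℤ.+ P) ℤ.+ (Y ℤ.+ Y)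
  regroup = ℤ-solve-∀
  step : ∀ Y → Y ℤ.* (+ 3 ℤ.* Y ℤ.- + 1) ℤ.+ (Y ℤ.+ Y) ≡ ℤ.- Y ℤ.* (+ 3 ℤ.* ℤ.- Y ℤ.- + 1)
  step = ℤ-solve-∀

pent-double : ∀ j → + pent j ℤ.+ + pent j ≡ j ℤ.* (+ 3 ℤ.* j ℤ.- + 1)
pent-double j = subst (λ p → + p ℤ.+ + p ≡ j ℤ.* (+ 3 ℤ.* j ℤ.- + 1)) (sym pent≡witness) (pentWitness-double j)
  where
  pent≡witness : pent j ≡ pentWitness j
  pent≡witness = trans (cong (λ y → ℤ.∣ y ∣ / 2) (sym (pentWitness-double j))) (half-double (pentWitness j))

double-injective : ∀ a b → a ℤ.+ a ≡ b ℤ.+ b → a ≡ b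
double-injective a b eq = ℤₚ.*-cancelˡ-≡ (+ 2) a b (trans (twice a) (trans eq (sym (twice b))))
  where
  twice : ∀ x → + 2 ℤ.* x ≡ x ℤ.+ x
  twice = ℤ-solve-∀

pent-suc : ∀ j → + pent (j ℤ.+ + 1) ≡ + pent j ℤ.+ (+ 3 ℤ.* j ℤ.+ + 1)
pent-suc j = double-injective _ _ (begin
  + pent (j ℤ.+ + 1) ℤ.+ + pent (j ℤ.+ + 1)                       ≡⟨ pent-double (j ℤ.+ + 1) ⟩
  (j ℤ.+ + 1) ℤ.* (+ 3 ℤ.* (j ℤ.+ + 1) ℤ.- + 1)                   ≡⟨ ℤ-solve (j ∷ []) ⟩
  j ℤ.* (+ 3 ℤ.* j ℤ.- + 1) ℤ.+ (+ 3 ℤ.* j ℤ.+ + 1) ℤ.+ (+ 3 ℤ.* j ℤ.+ + 1)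
    ≡⟨ cong (λ y → y ℤ.+ (+ 3 ℤ.* j ℤ.+ + 1) ℤ.+ (+ 3 ℤ.* j ℤ.+ + 1)) (pent-double j) ⟨
  + pent j ℤ.+ + pent j ℤ.+ (+ 3 ℤ.* j ℤ.+ + 1) ℤ.+ (+ 3 ℤ.* j ℤ.+ + 1)
    ≡⟨ regroup (+ pent j) j ⟩
  (+ pent j ℤ.+ (+ 3 ℤ.* j ℤ.+ + 1)) ℤ.+ (+ pent j ℤ.+ (+ 3 ℤ.* j ℤ.+ + 1)) ∎)
  where
  open ≡-Reasoning
  regroup : ∀ P j → P ℤ.+ P ℤ.+ (+ 3 ℤ.* j ℤ.+ + 1) ℤ.+ (+ 3 ℤ.* j ℤ.+ + 1) ≡
                    (P ℤ.+ (+ 3 ℤ.* j ℤ.+ + 1)) ℤ.+ (P ℤ.+ (+ 3 ℤ.* j ℤ.+ + 1))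
  regroup = ℤ-solve-∀

pent-exponent : ∀ a b K {α β ρ σ} → a ≡ + suc α → b ≡ + suc β →
  K ℤ.- (a ℤ.- b) ℤ.- + 1 ≡ + ρ → K ℤ.+ (a ℤ.- b) ≡ + σ →
  pent (a ℤ.- b) ℕ.+ suc α ℕ.+ σ ≡ pent (a ℤ.- b ℤ.+ + 1) ℕ.+ ρ ℕ.+ suc β
pent-exponent a b K {α} {β} {ρ} {σ} a≡ b≡ r′≡ s≡ = ℤₚ.+-injective (begin
  + (pent j ℕ.+ suc α ℕ.+ σ)                          ≡⟨ ℤₚ.pos-+ (pent j ℕ.+ suc α) σ ⟩
  + (pent j ℕ.+ suc α) ℤ.+ + σ                        ≡⟨ cong (ℤ._+ + σ) (ℤₚ.pos-+ (pent j) (suc α)) ⟩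
  + pent j ℤ.+ + suc α ℤ.+ + σ                        ≡⟨ cong₂ (λ x y → + pent j ℤ.+ x ℤ.+ y) a≡ s≡ ⟨
  + pent j ℤ.+ a ℤ.+ (K ℤ.+ j)                        ≡⟨ rearrange (+ pent j) a b K ⟩
  + pent j ℤ.+ (+ 3 ℤ.* j ℤ.+ + 1) ℤ.+ (K ℤ.- j ℤ.- + 1) ℤ.+ b
    ≡⟨ cong (λ x → x ℤ.+ (K ℤ.- j ℤ.- + 1) ℤ.+ b) (pent-suc j) ⟨
  + pent (j ℤ.+ + 1) ℤ.+ (K ℤ.- j ℤ.- + 1) ℤ.+ b      ≡⟨ cong₂ (λ x y → + pent (j ℤ.+ + 1) ℤ.+ x ℤ.+ y) r′≡ b≡ ⟩
  + pent (j ℤ.+ + 1) ℤ.+ + ρ ℤ.+ + suc β              ≡⟨ cong (ℤ._+ + suc β) (ℤₚ.pos-+ (pent (j ℤ.+ + 1)) ρ) ⟨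
  + (pent (j ℤ.+ + 1) ℕ.+ ρ) ℤ.+ + suc β              ≡⟨ ℤₚ.pos-+ (pent (j ℤ.+ + 1) ℕ.+ ρ) (suc β) ⟨
  + (pent (j ℤ.+ + 1) ℕ.+ ρ ℕ.+ suc β)                ∎)
  where
  open ≡-Reasoning
  j = a ℤ.- b
  rearrange : ∀ P a b K → P ℤ.+ a ℤ.+ (K ℤ.+ (a ℤ.- b)) ≡
              P ℤ.+ (+ 3 ℤ.* (a ℤ.- b) ℤ.+ + 1) ℤ.+ (K ℤ.- (a ℤ.- b) ℤ.- + 1) ℤ.+ b
  rearrange = ℤ-solve-∀

-- The summands and the termwise defect of the recurrence

summand : ℤ → ℤ → ℤ → PS
summand N K j = sign j ·ₚ (qpow (pent j) *ₚ
  (qbinom (floorHalf (N ℤ.+ j)) (K ℤ.- j) *ₚ qbinom (floorHalf (N ℤ.- j ℤ.+ + 1)) (K ℤ.+ j)))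

summand-shape : ∀ N K j {α β ρ τ} →
  floorHalf (N ℤ.+ j) ≡ α → floorHalf (N ℤ.- j ℤ.+ + 1) ≡ β → K ℤ.- j ≡ ρ → K ℤ.+ j ≡ τ →
  summand N K j ≋ (constₚ (sign j) *ₚ (qpow (pent j) *ₚ (qbinom α ρ *ₚ qbinom β τ)))
summand-shape N K j refl refl refl refl = coeffwise λ M →
  sym (constₚ-*ₚ (sign j) (qpow (pent j) *ₚ
    (qbinom (floorHalf (N ℤ.+ j)) (K ℤ.- j) *ₚ qbinom (floorHalf (N ℤ.- j ℤ.+ + 1)) (K ℤ.+ j))) M)

summand-vanishes-below : ∀ N {K m} → K ℕ.≤ m → summand N (+ K) -[1+ m ] ≋ 0ₚ
summand-vanishes-below N {K} {m} K≤m =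
  ·ₚ-vanish (sign -[1+ m ]) (*-vanishʳ (qpow (pent -[1+ m ]))
    (*-vanishʳ (qbinom (floorHalf (N ℤ.+ -[1+ m ])) (+ K ℤ.- -[1+ m ]))
      (qbinom-negʳ (floorHalf (N ℤ.- -[1+ m ] ℤ.+ + 1)) (negative-gap K≤m))))

summand-vanishes-above : ∀ N {K m} → K ℕ.≤ m → summand N (+ K) (+ suc m) ≋ 0ₚ
summand-vanishes-above N {K} {m} K≤m =
  ·ₚ-vanish (sign (+ suc m)) (*-vanishʳ (qpow (pent (+ suc m)))
    (*-vanishˡ (qbinom (floorHalf (N ℤ.- + suc m ℤ.+ + 1)) (+ K ℤ.+ + suc m))
      (qbinom-negʳ (floorHalf (N ℤ.+ + suc m)) (negative-gap K≤m))))

summand-vanishes-small : ∀ {n k} → n ℕ.< k ℕ.+ k → ∀ j → summand (+ n) (+ k) j ≋ 0ₚ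
summand-vanishes-small {n} {k} n<2k j =
  ·ₚ-vanish (sign j) (*-vanishʳ (qpow (pent j)) binomials-vanish)
  where
  α = floorHalf (+ n ℤ.+ j)
  β = floorHalf (+ n ℤ.- j ℤ.+ + 1)
  ρ = + k ℤ.- j
  τ = + k ℤ.+ j
  -- α + β = n < 2k = ρ + τ, so α < ρ or β < τ.
  binomials-vanish : (qbinom α ρ *ₚ qbinom β τ) ≋ 0ₚ
  binomials-vanish with α ℤ.<? ρ | β ℤ.<? τ
  ... | yes α<ρ | _ = *-vanishˡ (qbinom β τ) (qbinom-below α<ρ)
  ... | no _ | yes β<τ = *-vanishʳ (qbinom α ρ) (qbinom-below β<τ)
  ... | no α≮ρ | no β≮τ = ⊥-elim (ℕₚ.<⇒≱ n<2k (ℤₚ.drop‿+≤+ 2k≤n))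
    where
    2k≤n : + (k ℕ.+ k) ℤ.≤ + n
    2k≤n = subst₂ ℤ._≤_ (trans (cancel (+ k) j) (sym (ℤₚ.pos-+ k k))) (floorHalf-complement (+ n) j)
                  (ℤₚ.+-mono-≤ (ℤₚ.≮⇒≥ α≮ρ) (ℤₚ.≮⇒≥ β≮τ))
      where
      cancel : ∀ K j → (K ℤ.- j) ℤ.+ (K ℤ.+ j) ≡ K ℤ.+ K
      cancel = ℤ-solve-∀

defect : ℤ → ℤ → ℤ → PS
defect N K j =
  ((qpowℤ (K ℤ.+ K) *ₚ summand N K j) +ₚ (-ₚ (qpowℤ (K ℤ.+ K) *ₚ summand (N ℤ.- + 1) K j)))
  +ₚ (-ₚ (qpowℤ N *ₚ summand (N ℤ.- + 2) (K ℤ.- + 1) j))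

defect-vanishes : ∀ N K j → summand N K j ≋ 0ₚ → summand (N ℤ.- + 1) K j ≋ 0ₚ →
  summand (N ℤ.- + 2) (K ℤ.- + 1) j ≋ 0ₚ → defect N K j ≋ 0ₚ
defect-vanishes N K j s₀≋0 s₁≋0 s₂≋0 = ≋-trans
  (+-cong (+-cong (*-vanishʳ (qpowℤ (K ℤ.+ K)) s₀≋0) (-‿cong (*-vanishʳ (qpowℤ (K ℤ.+ K)) s₁≋0)))
          (-‿cong (*-vanishʳ (qpowℤ N) s₂≋0)))
  (coeffwise λ _ → refl)

factor-defect : ∀ Q Qn σ P A₁ A₂ A₃ →
  (((Q *ₚ (σ *ₚ (P *ₚ A₁))) +ₚ (-ₚ (Q *ₚ (σ *ₚ (P *ₚ A₂))))) +ₚ (-ₚ (Qn *ₚ (σ *ₚ (P *ₚ A₃)))))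
  ≋ (σ *ₚ (P *ₚ (((Q *ₚ A₁) +ₚ (-ₚ (Q *ₚ A₂))) +ₚ (-ₚ (Qn *ₚ A₃)))))
factor-defect = solve 7 (λ Q Qn σ P A₁ A₂ A₃ →
  ((Q :* (σ :* (P :* A₁))) :- (Q :* (σ :* (P :* A₂)))) :- (Qn :* (σ :* (P :* A₃)))
  := σ :* (P :* (((Q :* A₁) :- (Q :* A₂)) :- (Qn :* A₃)))) ≋-refl

defect-even : ∀ a b K →
  let j = a ℤ.- b
      r = K ℤ.- j
      s = K ℤ.+ j
  in ¬ (a ≡ + 0 × r ≡ + 0) → ¬ (b ≡ + 0 × s ≡ + 0) →
     defect (a ℤ.+ b) K j ≋
     (constₚ (sign j) *ₚ (qpow (pent j) *ₚ
       ((qpowℤ a *ₚ qbinom (a ℤ.- + 1) (r ℤ.- + 1)) *ₚ (qpowℤ s *ₚ qbinom (b ℤ.- + 1) s))))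
defect-even a b K a,r≢0 b,s≢0 = begin
  defect (a ℤ.+ b) K j
    ≈⟨ +-cong (+-cong (*-congˡ {x = Q} shape₀) (-‿cong (*-congˡ {x = Q} shape₁)))
              (-‿cong (*-congˡ {x = qpowℤ (a ℤ.+ b)} shape₂)) ⟩
  ((Q *ₚ (σ *ₚ (P *ₚ (B a r *ₚ B b s)))) +ₚ (-ₚ (Q *ₚ (σ *ₚ (P *ₚ (B a′ r *ₚ B b s))))))
    +ₚ (-ₚ (qpowℤ (a ℤ.+ b) *ₚ (σ *ₚ (P *ₚ (B a′ r′ *ₚ B b′ s′)))))
    ≈⟨ factor-defect Q (qpowℤ (a ℤ.+ b)) σ P (B a r *ₚ B b s) (B a′ r *ₚ B b s) (B a′ r′ *ₚ B b′ s′) ⟩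
  σ *ₚ (P *ₚ (((Q *ₚ (B a r *ₚ B b s)) +ₚ (-ₚ (Q *ₚ (B a′ r *ₚ B b s))))
               +ₚ (-ₚ (qpowℤ (a ℤ.+ b) *ₚ (B a′ r′ *ₚ B b′ s′)))))
    ≈⟨ *-congˡ {x = σ} (*-congˡ {x = P} (+-cong (+-cong split₀ (-‿cong split₁)) (-‿cong split₂))) ⟩
  σ *ₚ (P *ₚ (((W r a r *ₚ W s b s) +ₚ (-ₚ (W r a′ r *ₚ W s b s))) +ₚ (-ₚ (W a a′ r′ *ₚ W b b′ s′))))
    ≈⟨ *-congˡ {x = σ} (*-congˡ {x = P} (pascal-difference₁ (W r a′ r) (W s b′ s) (W a a′ r′) (W b b′ s′)
                                            (qbinom-pascal a r a,r≢0) (qbinom-pascal b s b,s≢0))) ⟩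
  σ *ₚ (P *ₚ (W a a′ r′ *ₚ W s b′ s)) ∎
  where
  open ≋-Reasoning
  j = a ℤ.- b
  r = K ℤ.- j
  s = K ℤ.+ j
  a′ = a ℤ.- + 1
  b′ = b ℤ.- + 1
  r′ = r ℤ.- + 1
  s′ = s ℤ.- + 1
  B = qbinom
  W : ℤ → ℤ → ℤ → PS
  W x α ρ = qpowℤ x *ₚ qbinom α ρ
  Q = qpowℤ (K ℤ.+ K)
  σ = constₚ (sign j)
  P = qpow (pent j)
  shape₀ : summand (a ℤ.+ b) K j ≋ (σ *ₚ (P *ₚ (B a r *ₚ B b s)))
  shape₀ = summand-shape (a ℤ.+ b) K (a ℤ.- b)
    (floorHalf-even a (ℤ-solve (a ∷ b ∷ []))) (floorHalf-odd b (ℤ-solve (a ∷ b ∷ []))) refl refl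
  shape₁ : summand (a ℤ.+ b ℤ.- + 1) K j ≋ (σ *ₚ (P *ₚ (B a′ r *ₚ B b s)))
  shape₁ = summand-shape (a ℤ.+ b ℤ.- + 1) K (a ℤ.- b)
    (floorHalf-odd (a ℤ.- + 1) (ℤ-solve (a ∷ b ∷ []))) (floorHalf-even b (ℤ-solve (a ∷ b ∷ []))) refl refl
  shape₂ : summand (a ℤ.+ b ℤ.- + 2) (K ℤ.- + 1) j ≋ (σ *ₚ (P *ₚ (B a′ r′ *ₚ B b′ s′)))
  shape₂ = summand-shape (a ℤ.+ b ℤ.- + 2) (K ℤ.- + 1) (a ℤ.- b)
    {ρ = K ℤ.- (a ℤ.- b) ℤ.- + 1} {τ = K ℤ.+ (a ℤ.- b) ℤ.- + 1}
    (floorHalf-even (a ℤ.- + 1) (ℤ-solve (a ∷ b ∷ []))) (floorHalf-odd (b ℤ.- + 1) (ℤ-solve (a ∷ b ∷ [])))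
    (ℤ-solve (a ∷ b ∷ K ∷ [])) (ℤ-solve (a ∷ b ∷ K ∷ []))
  2K≡r+s : K ℤ.+ K ≡ (K ℤ.- (a ℤ.- b)) ℤ.+ (K ℤ.+ (a ℤ.- b))
  2K≡r+s = ℤ-solve (a ∷ b ∷ K ∷ [])
  Q≡ : Q ≡ qpowℤ (r ℤ.+ s)
  Q≡ = cong qpowℤ 2K≡r+s
  split₀ : (Q *ₚ (B a r *ₚ B b s)) ≋ (W r a r *ₚ W s b s)
  split₀ = ≋-trans (≡⇒≋ (cong (_*ₚ (B a r *ₚ B b s)) Q≡)) (qpowℤ-split r s (qbinom-negʳ a) (qbinom-negʳ b))
  split₁ : (Q *ₚ (B a′ r *ₚ B b s)) ≋ (W r a′ r *ₚ W s b s)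
  split₁ = ≋-trans (≡⇒≋ (cong (_*ₚ (B a′ r *ₚ B b s)) Q≡)) (qpowℤ-split r s (qbinom-negʳ a′) (qbinom-negʳ b))
  split₂ : (qpowℤ (a ℤ.+ b) *ₚ (B a′ r′ *ₚ B b′ s′)) ≋ (W a a′ r′ *ₚ W b b′ s′)
  split₂ = qpowℤ-split a b (qbinom-pred-negˡ r′) (qbinom-pred-negˡ s′)

defect-odd : ∀ a b K →
  let j = a ℤ.- b
      r = K ℤ.- j
      s = K ℤ.+ j
  in ¬ (a ≡ + 0 × r ℤ.- + 1 ≡ + 0) → ¬ (b ≡ + 0 × s ℤ.+ + 1 ≡ + 0) →
     defect (a ℤ.+ b) K (j ℤ.+ + 1) ≋
     (constₚ (sign (j ℤ.+ + 1)) *ₚ (qpow (pent (j ℤ.+ + 1)) *ₚ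
       ((qpowℤ (r ℤ.- + 1) *ₚ qbinom (a ℤ.- + 1) (r ℤ.- + 1)) *ₚ (qpowℤ b *ₚ qbinom (b ℤ.- + 1) s))))
defect-odd a b K a,r′≢0 b,s⁺≢0 = begin
  defect (a ℤ.+ b) K j′
    ≈⟨ +-cong (+-cong (*-congˡ {x = Q} shape₀) (-‿cong (*-congˡ {x = Q} shape₁)))
              (-‿cong (*-congˡ {x = qpowℤ (a ℤ.+ b)} shape₂)) ⟩
  ((Q *ₚ (σ *ₚ (P *ₚ (B a r′ *ₚ B b s⁺)))) +ₚ (-ₚ (Q *ₚ (σ *ₚ (P *ₚ (B a r′ *ₚ B b′ s⁺))))))
    +ₚ (-ₚ (qpowℤ (a ℤ.+ b) *ₚ (σ *ₚ (P *ₚ (B a′ r″ *ₚ B b′ s)))))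
    ≈⟨ factor-defect Q (qpowℤ (a ℤ.+ b)) σ P (B a r′ *ₚ B b s⁺) (B a r′ *ₚ B b′ s⁺) (B a′ r″ *ₚ B b′ s) ⟩
  σ *ₚ (P *ₚ (((Q *ₚ (B a r′ *ₚ B b s⁺)) +ₚ (-ₚ (Q *ₚ (B a r′ *ₚ B b′ s⁺))))
               +ₚ (-ₚ (qpowℤ (a ℤ.+ b) *ₚ (B a′ r″ *ₚ B b′ s)))))
    ≈⟨ *-congˡ {x = σ} (*-congˡ {x = P} (+-cong (+-cong split₀ (-‿cong split₁)) (-‿cong split₂))) ⟩
  σ *ₚ (P *ₚ (((W r′ a r′ *ₚ W s⁺ b s⁺) +ₚ (-ₚ (W r′ a r′ *ₚ W s⁺ b′ s⁺))) +ₚ (-ₚ (W a a′ r″ *ₚ W b b′ s))))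
    ≈⟨ *-congˡ {x = σ} (*-congˡ {x = P} (pascal-difference₂ (W r′ a′ r′) (W s⁺ b′ s⁺) (W a a′ r″) (W b b′ s)
                                            (qbinom-pascal a r′ a,r′≢0) pascal-b)) ⟩
  σ *ₚ (P *ₚ (W r′ a′ r′ *ₚ W b b′ s)) ∎
  where
  open ≋-Reasoning
  j = a ℤ.- b
  j′ = j ℤ.+ + 1
  r = K ℤ.- j
  s = K ℤ.+ j
  r′ = r ℤ.- + 1
  r″ = r′ ℤ.- + 1
  s⁺ = s ℤ.+ + 1
  a′ = a ℤ.- + 1
  b′ = b ℤ.- + 1
  B = qbinom
  W : ℤ → ℤ → ℤ → PS
  W x α ρ = qpowℤ x *ₚ qbinom α ρ
  Q = qpowℤ (K ℤ.+ K)
  σ = constₚ (sign j′)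
  P = qpow (pent j′)
  shape₀ : summand (a ℤ.+ b) K j′ ≋ (σ *ₚ (P *ₚ (B a r′ *ₚ B b s⁺)))
  shape₀ = summand-shape (a ℤ.+ b) K (a ℤ.- b ℤ.+ + 1)
    {ρ = K ℤ.- (a ℤ.- b) ℤ.- + 1} {τ = K ℤ.+ (a ℤ.- b) ℤ.+ + 1}
    (floorHalf-odd a (ℤ-solve (a ∷ b ∷ []))) (floorHalf-even b (ℤ-solve (a ∷ b ∷ [])))
    (ℤ-solve (a ∷ b ∷ K ∷ [])) (ℤ-solve (a ∷ b ∷ K ∷ []))
  shape₁ : summand (a ℤ.+ b ℤ.- + 1) K j′ ≋ (σ *ₚ (P *ₚ (B a r′ *ₚ B b′ s⁺)))
  shape₁ = summand-shape (a ℤ.+ b ℤ.- + 1) K (a ℤ.- b ℤ.+ + 1)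
    {ρ = K ℤ.- (a ℤ.- b) ℤ.- + 1} {τ = K ℤ.+ (a ℤ.- b) ℤ.+ + 1}
    (floorHalf-even a (ℤ-solve (a ∷ b ∷ []))) (floorHalf-odd (b ℤ.- + 1) (ℤ-solve (a ∷ b ∷ [])))
    (ℤ-solve (a ∷ b ∷ K ∷ [])) (ℤ-solve (a ∷ b ∷ K ∷ []))
  shape₂ : summand (a ℤ.+ b ℤ.- + 2) (K ℤ.- + 1) j′ ≋ (σ *ₚ (P *ₚ (B a′ r″ *ₚ B b′ s)))
  shape₂ = summand-shape (a ℤ.+ b ℤ.- + 2) (K ℤ.- + 1) (a ℤ.- b ℤ.+ + 1)
    {ρ = K ℤ.- (a ℤ.- b) ℤ.- + 1 ℤ.- + 1} {τ = K ℤ.+ (a ℤ.- b)}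
    (floorHalf-odd (a ℤ.- + 1) (ℤ-solve (a ∷ b ∷ []))) (floorHalf-even (b ℤ.- + 1) (ℤ-solve (a ∷ b ∷ [])))
    (ℤ-solve (a ∷ b ∷ K ∷ [])) (ℤ-solve (a ∷ b ∷ K ∷ []))
  2K≡r′+s⁺ : K ℤ.+ K ≡ (K ℤ.- (a ℤ.- b) ℤ.- + 1) ℤ.+ (K ℤ.+ (a ℤ.- b) ℤ.+ + 1)
  2K≡r′+s⁺ = ℤ-solve (a ∷ b ∷ K ∷ [])
  s⁺-1≡s : K ℤ.+ (a ℤ.- b) ℤ.+ + 1 ℤ.- + 1 ≡ K ℤ.+ (a ℤ.- b)
  s⁺-1≡s = ℤ-solve (a ∷ b ∷ K ∷ [])
  split₀ : (Q *ₚ (B a r′ *ₚ B b s⁺)) ≋ (W r′ a r′ *ₚ W s⁺ b s⁺)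
  split₀ = ≋-trans (≡⇒≋ (cong (λ e → qpowℤ e *ₚ (B a r′ *ₚ B b s⁺)) 2K≡r′+s⁺))
                   (qpowℤ-split r′ s⁺ (qbinom-negʳ a) (qbinom-negʳ b))
  split₁ : (Q *ₚ (B a r′ *ₚ B b′ s⁺)) ≋ (W r′ a r′ *ₚ W s⁺ b′ s⁺)
  split₁ = ≋-trans (≡⇒≋ (cong (λ e → qpowℤ e *ₚ (B a r′ *ₚ B b′ s⁺)) 2K≡r′+s⁺))
                   (qpowℤ-split r′ s⁺ (qbinom-negʳ a) (qbinom-negʳ b′))
  split₂ : (qpowℤ (a ℤ.+ b) *ₚ (B a′ r″ *ₚ B b′ s)) ≋ (W a a′ r″ *ₚ W b b′ s)
  split₂ = qpowℤ-split a b (qbinom-pred-negˡ r″) (qbinom-pred-negˡ s)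
  pascal-b : W s⁺ b s⁺ ≋ (W s⁺ b′ s⁺ +ₚ W b b′ s)
  pascal-b = ≋-trans (qbinom-pascal b s⁺ b,s⁺≢0)
                     (+-congˡ {x = W s⁺ b′ s⁺} (≡⇒≋ (cong (W b b′) s⁺-1≡s)))

vanishing-weightˡ : ∀ P A B {X} Y → X ≋ 0ₚ → (P *ₚ ((A *ₚ X) *ₚ (B *ₚ Y))) ≋ 0ₚ
vanishing-weightˡ P A B Y X≋0 = *-vanishʳ P (*-vanishˡ (B *ₚ Y) (*-vanishʳ A X≋0))

vanishing-weightʳ : ∀ P A B X {Y} → Y ≋ 0ₚ → (P *ₚ ((A *ₚ X) *ₚ (B *ₚ Y))) ≋ 0ₚ
vanishing-weightʳ P A B X Y≋0 = *-vanishʳ P (*-vanishʳ (A *ₚ X) (*-vanishʳ B Y≋0))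

pent-weights : ∀ a b K →
  let j = a ℤ.- b
      X = qbinom (a ℤ.- + 1) (K ℤ.- j ℤ.- + 1)
      Y = qbinom (b ℤ.- + 1) (K ℤ.+ j)
  in (qpow (pent j) *ₚ ((qpowℤ a *ₚ X) *ₚ (qpowℤ (K ℤ.+ j) *ₚ Y))) ≋
     (qpow (pent (j ℤ.+ + 1)) *ₚ ((qpowℤ (K ℤ.- j ℤ.- + 1) *ₚ X) *ₚ (qpowℤ b *ₚ Y)))
pent-weights a b K = by-view (qbinom-view (a ℤ.- + 1) r′) (qbinom-view (b ℤ.- + 1) s)
  where
  open ≋-Reasoning
  j = a ℤ.- b
  r′ = K ℤ.- j ℤ.- + 1
  s = K ℤ.+ j
  X = qbinom (a ℤ.- + 1) r′
  Y = qbinom (b ℤ.- + 1) s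
  P = qpow (pent j)
  P′ = qpow (pent (j ℤ.+ + 1))
  by-view : QBinomView (a ℤ.- + 1) r′ → QBinomView (b ℤ.- + 1) s →
    (P *ₚ ((qpowℤ a *ₚ X) *ₚ (qpowℤ s *ₚ Y))) ≋ (P′ *ₚ ((qpowℤ r′ *ₚ X) *ₚ (qpowℤ b *ₚ Y)))
  by-view (inj₁ X≋0) _ = ≋-trans (vanishing-weightˡ P (qpowℤ a) (qpowℤ s) Y X≋0)
                                 (≋-sym (vanishing-weightˡ P′ (qpowℤ r′) (qpowℤ b) Y X≋0))
  by-view (inj₂ _) (inj₁ Y≋0) = ≋-trans (vanishing-weightʳ P (qpowℤ a) (qpowℤ s) X Y≋0)
                                        (≋-sym (vanishing-weightʳ P′ (qpowℤ r′) (qpowℤ b) X Y≋0))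
  by-view (inj₂ (α , ρ , a-1≡α , r′≡ρ)) (inj₂ (β , σ , b-1≡β , s≡σ)) = begin
    P *ₚ ((qpowℤ a *ₚ X) *ₚ (qpowℤ s *ₚ Y))
      ≡⟨ cong₂ (λ x y → P *ₚ ((qpowℤ x *ₚ X) *ₚ (qpowℤ y *ₚ Y))) (pred≡⇒≡suc a a-1≡α) s≡σ ⟩
    P *ₚ ((qpow (suc α) *ₚ X) *ₚ (qpow σ *ₚ Y))
      ≈⟨ qpow-collect (pent j) (suc α) σ X Y ⟩
    qpow (pent j ℕ.+ suc α ℕ.+ σ) *ₚ (X *ₚ Y)
      ≡⟨ cong (λ e → qpow e *ₚ (X *ₚ Y)) (pent-exponent a b K (pred≡⇒≡suc a a-1≡α) (pred≡⇒≡suc b b-1≡β) r′≡ρ s≡σ) ⟩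
    qpow (pent (j ℤ.+ + 1) ℕ.+ ρ ℕ.+ suc β) *ₚ (X *ₚ Y)
      ≈⟨ qpow-collect (pent (j ℤ.+ + 1)) ρ (suc β) X Y ⟨
    P′ *ₚ ((qpow ρ *ₚ X) *ₚ (qpow (suc β) *ₚ Y))
      ≡⟨ cong₂ (λ x y → P′ *ₚ ((qpowℤ x *ₚ X) *ₚ (qpowℤ y *ₚ Y))) r′≡ρ (pred≡⇒≡suc b b-1≡β) ⟨
    P′ *ₚ ((qpowℤ r′ *ₚ X) *ₚ (qpowℤ b *ₚ Y)) ∎

-- N + K ≥ 2 keeps all four applications of the q-Pascal rule away from its exceptional case.
defect-pairing : ∀ a b K p → (a ℤ.+ b) ℤ.+ K ≡ + suc (suc p) →
  (defect (a ℤ.+ b) K (a ℤ.- b) +ₚ defect (a ℤ.+ b) K (a ℤ.- b ℤ.+ + 1)) ≋ 0ₚ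
defect-pairing a b K p N+K≡2+p = begin
  defect (a ℤ.+ b) K j +ₚ defect (a ℤ.+ b) K (j ℤ.+ + 1)
    ≈⟨ +-cong (defect-even a b K nondeg₁ nondeg₂) (defect-odd a b K nondeg₃ nondeg₄) ⟩
  (σ *ₚ T) +ₚ (σ′ *ₚ T′)
    ≈⟨ +-cong (*-congˡ {x = σ} (pent-weights a b K)) (*-congʳ {x = T′} (≡⇒≋ (cong constₚ (sign-suc j)))) ⟩
  (σ *ₚ T′) +ₚ (constₚ (ℤ.- sign j) *ₚ T′)
    ≈⟨ +-congˡ {x = σ *ₚ T′} (*-congʳ {x = T′} (constₚ-neg (sign j))) ⟩
  (σ *ₚ T′) +ₚ ((-ₚ σ) *ₚ T′)
    ≈⟨ distribʳ T′ σ (-ₚ σ) ⟨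
  (σ +ₚ (-ₚ σ)) *ₚ T′
    ≈⟨ *-vanishˡ T′ (-‿inverseʳ σ) ⟩
  0ₚ ∎
  where
  open ≋-Reasoning
  j = a ℤ.- b
  σ = constₚ (sign j)
  σ′ = constₚ (sign (j ℤ.+ + 1))
  T = qpow (pent j) *ₚ
        ((qpowℤ a *ₚ qbinom (a ℤ.- + 1) (K ℤ.- j ℤ.- + 1)) *ₚ (qpowℤ (K ℤ.+ j) *ₚ qbinom (b ℤ.- + 1) (K ℤ.+ j)))
  T′ = qpow (pent (j ℤ.+ + 1)) *ₚ
         ((qpowℤ (K ℤ.- j ℤ.- + 1) *ₚ qbinom (a ℤ.- + 1) (K ℤ.- j ℤ.- + 1))
          *ₚ (qpowℤ b *ₚ qbinom (b ℤ.- + 1) (K ℤ.+ j)))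
  nondeg₁ : ¬ (a ≡ + 0 × K ℤ.- (a ℤ.- b) ≡ + 0)
  nondeg₁ = pascal-nondegenerate a (K ℤ.- (a ℤ.- b)) (suc p)
    (trans {j = a ℤ.+ b ℤ.+ K} (ℤ-solve (a ∷ b ∷ K ∷ [])) N+K≡2+p)
  nondeg₂ : ¬ (b ≡ + 0 × K ℤ.+ (a ℤ.- b) ≡ + 0)
  nondeg₂ = pascal-nondegenerate b (K ℤ.+ (a ℤ.- b)) (suc p)
    (trans {j = a ℤ.+ b ℤ.+ K} (ℤ-solve (a ∷ b ∷ K ∷ [])) N+K≡2+p)
  nondeg₃ : ¬ (a ≡ + 0 × K ℤ.- (a ℤ.- b) ℤ.- + 1 ≡ + 0)
  nondeg₃ = pascal-nondegenerate a (K ℤ.- (a ℤ.- b) ℤ.- + 1) p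
    (trans {j = a ℤ.+ b ℤ.+ K ℤ.- + 1} (ℤ-solve (a ∷ b ∷ K ∷ [])) (cong (ℤ._- + 1) N+K≡2+p))
  nondeg₄ : ¬ (b ≡ + 0 × K ℤ.+ (a ℤ.- b) ℤ.+ + 1 ≡ + 0)
  nondeg₄ = pascal-nondegenerate b (K ℤ.+ (a ℤ.- b) ℤ.+ + 1) (suc (p ℕ.+ 1))
    (trans {j = a ℤ.+ b ℤ.+ K ℤ.+ + 1} (ℤ-solve (a ∷ b ∷ K ∷ [])) (cong (ℤ._+ + 1) N+K≡2+p))

-- Symmetric sums

open UpTo (CommutativeRing.+-commutativeMonoid PS-commutativeRing)
  using ()
  renaming (fold to infix 30 ∑[<_]_; fold-suc to ∑-suc; fold-cong to ∑-cong; fold-snoc to ∑-snoc; fold-ε to ∑-0)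

∑-*ˡ : ∀ L x F → ∑[< L ] (λ t → x *ₚ F t) ≋ (x *ₚ ∑[< L ] F)
∑-*ˡ zero x F = ≋-sym (zeroʳ x)
∑-*ˡ (suc L) x F = begin
  ∑[< suc L ] (λ t → x *ₚ F t)               ≡⟨ ∑-suc L (λ t → x *ₚ F t) ⟩
  (x *ₚ F 0) +ₚ ∑[< L ] (λ t → x *ₚ F (suc t)) ≈⟨ +-congˡ {x = x *ₚ F 0} (∑-*ˡ L x (F ∘ suc)) ⟩
  (x *ₚ F 0) +ₚ (x *ₚ ∑[< L ] (F ∘ suc))     ≈⟨ distribˡ x (F 0) (∑[< L ] (F ∘ suc)) ⟨
  x *ₚ (F 0 +ₚ ∑[< L ] (F ∘ suc))            ≡⟨ cong (x *ₚ_) (∑-suc L F) ⟨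
  x *ₚ ∑[< suc L ] F                         ∎
  where open ≋-Reasoning

∑-− : ∀ L F G → ∑[< L ] (λ t → F t +ₚ (-ₚ G t)) ≋ (∑[< L ] F +ₚ (-ₚ ∑[< L ] G))
∑-− zero F G = ≋-sym (-‿inverseʳ 0ₚ)
∑-− (suc L) F G = begin
  ∑[< suc L ] (λ t → F t +ₚ (-ₚ G t))
    ≡⟨ ∑-suc L (λ t → F t +ₚ (-ₚ G t)) ⟩
  (F 0 +ₚ (-ₚ G 0)) +ₚ ∑[< L ] (λ t → F (suc t) +ₚ (-ₚ G (suc t)))
    ≈⟨ +-congˡ {x = F 0 +ₚ (-ₚ G 0)} (∑-− L (F ∘ suc) (G ∘ suc)) ⟩
  (F 0 +ₚ (-ₚ G 0)) +ₚ (∑[< L ] (F ∘ suc) +ₚ (-ₚ ∑[< L ] (G ∘ suc)))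
    ≈⟨ solve 4 (λ f g F G → (f :- g) :+ (F :- G) := (f :+ F) :- (g :+ G))
               ≋-refl (F 0) (G 0) (∑[< L ] (F ∘ suc)) (∑[< L ] (G ∘ suc)) ⟩
  (F 0 +ₚ ∑[< L ] (F ∘ suc)) +ₚ (-ₚ (G 0 +ₚ ∑[< L ] (G ∘ suc)))
    ≡⟨ cong₂ (λ x y → x +ₚ (-ₚ y)) (∑-suc L F) (∑-suc L G) ⟨
  ∑[< suc L ] F +ₚ (-ₚ ∑[< suc L ] G) ∎
  where open ≋-Reasoning

∑-telescope : ∀ L (H : ℕ → PS) → ∑[< L ] (λ t → H t +ₚ (-ₚ H (suc t))) ≋ (H 0 +ₚ (-ₚ H L))
∑-telescope zero H = ≋-sym (-‿inverseʳ (H 0))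
∑-telescope (suc L) H = begin
  ∑[< suc L ] (λ t → H t +ₚ (-ₚ H (suc t)))
    ≡⟨ ∑-suc L (λ t → H t +ₚ (-ₚ H (suc t))) ⟩
  (H 0 +ₚ (-ₚ H 1)) +ₚ ∑[< L ] (λ t → H (suc t) +ₚ (-ₚ H (suc (suc t))))
    ≈⟨ +-congˡ {x = H 0 +ₚ (-ₚ H 1)} (∑-telescope L (H ∘ suc)) ⟩
  (H 0 +ₚ (-ₚ H 1)) +ₚ (H 1 +ₚ (-ₚ H (suc L)))
    ≈⟨ solve 3 (λ a b c → (a :- b) :+ (b :- c) := a :- c) ≋-refl (H 0) (H 1) (H (suc L)) ⟩
  H 0 +ₚ (-ₚ H (suc L)) ∎
  where open ≋-Reasoning

sumSym-cong : ∀ c {f g} → (∀ j → f j ≋ g j) → sumSym c f ≋ sumSym c g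
sumSym-cong c f≋g = ∑-cong (suc (2 ℕ.* c)) (λ t → f≋g (+ t ℤ.- + c))

sumSym-suc : ∀ c f → f -[1+ c ] ≋ 0ₚ → f (+ suc c) ≋ 0ₚ → sumSym (suc c) f ≋ sumSym c f
sumSym-suc c f f[-c-1]≋0 f[c+1]≋0 = begin
  sumSym (suc c) f
    ≡⟨ cong (λ L → ∑[< suc L ] (λ t → f (+ t ℤ.- + suc c))) (cong suc (ℕₚ.+-suc c (c ℕ.+ 0))) ⟩
  ∑[< suc (suc L) ] (λ t → f (+ t ℤ.- + suc c))
    ≡⟨ ∑-suc (suc L) (λ t → f (+ t ℤ.- + suc c)) ⟩
  f -[1+ c ] +ₚ ∑[< suc L ] (λ t → f (+ suc t ℤ.- + suc c))
    ≈⟨ +-cong f[-c-1]≋0 (∑-cong (suc L) (λ t → ≡⇒≋ (cong f ([1+t]-[1+c]≡t-c t c)))) ⟩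
  0ₚ +ₚ ∑[< suc L ] (λ t → f (+ t ℤ.- + c))
    ≈⟨ +-identityˡ _ ⟩
  ∑[< suc L ] (λ t → f (+ t ℤ.- + c))
    ≈⟨ ∑-snoc L (λ t → f (+ t ℤ.- + c)) ⟩
  sumSym c f +ₚ f (+ L ℤ.- + c)
    ≈⟨ +-congˡ {x = sumSym c f} (≋-trans (≡⇒≋ (cong f ([1+2c]-c≡1+c c))) f[c+1]≋0) ⟩
  sumSym c f +ₚ 0ₚ
    ≈⟨ +-identityʳ (sumSym c f) ⟩
  sumSym c f ∎
  where
  open ≋-Reasoning
  L = suc (2 ℕ.* c)

sumSym-telescope : ∀ c (G : ℤ → PS) →
  sumSym c (λ j → G j +ₚ (-ₚ G (j ℤ.+ + 1))) ≋ (G (+ 0 ℤ.- + c) +ₚ (-ₚ G (+ suc c)))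
sumSym-telescope c G = begin
  sumSym c (λ j → G j +ₚ (-ₚ G (j ℤ.+ + 1)))
    ≈⟨ ∑-cong (suc (2 ℕ.* c)) (λ t → +-congˡ {x = G (+ t ℤ.- + c)} (-‿cong (≡⇒≋ (cong G (next t))))) ⟩
  ∑[< suc (2 ℕ.* c) ] (λ t → G (+ t ℤ.- + c) +ₚ (-ₚ G (+ suc t ℤ.- + c)))
    ≈⟨ ∑-telescope (suc (2 ℕ.* c)) (λ t → G (+ t ℤ.- + c)) ⟩
  G (+ 0 ℤ.- + c) +ₚ (-ₚ G (+ suc (2 ℕ.* c) ℤ.- + c))
    ≡⟨ cong (λ j → G (+ 0 ℤ.- + c) +ₚ (-ₚ G j)) ([1+2c]-c≡1+c c) ⟩
  G (+ 0 ℤ.- + c) +ₚ (-ₚ G (+ suc c)) ∎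
  where
  open ≋-Reasoning
  next : ∀ t → + t ℤ.- + c ℤ.+ + 1 ≡ + suc t ℤ.- + c
  next t = shift (+ t) (+ c)
    where
    shift : ∀ T C → T ℤ.- C ℤ.+ + 1 ≡ (+ 1 ℤ.+ T) ℤ.- C
    shift = ℤ-solve-∀

module PairwiseCancellation (N : ℤ) (E : ℤ → PS)
  (pair : ∀ j h → N ℤ.+ j ≡ h ℤ.+ h → (E j +ₚ E (j ℤ.+ + 1)) ≋ 0ₚ) where

  oddPart : ∀ j → Parity (N ℤ.+ j) → PS
  oddPart j (inj₁ _) = 0ₚ
  oddPart j (inj₂ _) = E j

  -- Keeping E only where N + j is odd gives G with E j = G j - G (j + 1).
  G : ℤ → PS
  G j = oddPart j (parity (N ℤ.+ j))

  E≋G-difference : ∀ j → E j ≋ (G j +ₚ (-ₚ G (j ℤ.+ + 1)))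
  E≋G-difference j = from-parities (parity (N ℤ.+ j)) (parity (N ℤ.+ (j ℤ.+ + 1)))
    where
    N+[j+1] : N ℤ.+ (j ℤ.+ + 1) ≡ N ℤ.+ j ℤ.+ + 1
    N+[j+1] = sym (ℤₚ.+-assoc N j (+ 1))
    from-parities : ∀ p p′ → E j ≋ (oddPart j p +ₚ (-ₚ oddPart (j ℤ.+ + 1) p′))
    from-parities (inj₁ (h , e)) (inj₁ (h′ , e′)) =
      ⊥-elim (even≢odd h′ h (trans (sym e′) (trans N+[j+1] (cong (ℤ._+ + 1) e))))
    from-parities (inj₁ (h , e)) (inj₂ _) = begin
      E j
        ≈⟨ solve 2 (λ x y → x := (x :+ y) :- y) ≋-refl (E j) (E (j ℤ.+ + 1)) ⟩
      (E j +ₚ E (j ℤ.+ + 1)) +ₚ (-ₚ E (j ℤ.+ + 1))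
        ≈⟨ +-congʳ {x = -ₚ E (j ℤ.+ + 1)} (pair j h e) ⟩
      0ₚ +ₚ (-ₚ E (j ℤ.+ + 1)) ∎
      where open ≋-Reasoning
    from-parities (inj₂ _) (inj₁ _) = coeffwise λ M → sym (ℤₚ.+-identityʳ (E j M))
    from-parities (inj₂ (h , e)) (inj₂ (h′ , e′)) =
      ⊥-elim (even≢odd (h ℤ.+ + 1) h′
        (trans (sym (trans (cong (ℤ._+ + 1) e) (regroup h))) (trans (sym N+[j+1]) e′)))
      where
      regroup : ∀ h → h ℤ.+ h ℤ.+ + 1 ℤ.+ + 1 ≡ (h ℤ.+ + 1) ℤ.+ (h ℤ.+ + 1)
      regroup = ℤ-solve-∀

  G-vanishes : ∀ j → E j ≋ 0ₚ → G j ≋ 0ₚ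
  G-vanishes j Ej≋0 = oddPart-vanishes (parity (N ℤ.+ j))
    where
    oddPart-vanishes : ∀ p → oddPart j p ≋ 0ₚ
    oddPart-vanishes (inj₁ _) = ≋-refl
    oddPart-vanishes (inj₂ _) = Ej≋0

  sumSym-vanishes : ∀ c → E (+ 0 ℤ.- + c) ≋ 0ₚ → E (+ suc c) ≋ 0ₚ → sumSym c E ≋ 0ₚ
  sumSym-vanishes c E[-c]≋0 E[c+1]≋0 = begin
    sumSym c E
      ≈⟨ sumSym-cong c E≋G-difference ⟩
    sumSym c (λ j → G j +ₚ (-ₚ G (j ℤ.+ + 1)))
      ≈⟨ sumSym-telescope c G ⟩
    G (+ 0 ℤ.- + c) +ₚ (-ₚ G (+ suc c))
      ≈⟨ +-cong (G-vanishes _ E[-c]≋0) (-‿cong (G-vanishes _ E[c+1]≋0)) ⟩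
    0ₚ +ₚ (-ₚ 0ₚ)
      ≈⟨ -‿inverseʳ 0ₚ ⟩
    0ₚ ∎
    where open ≋-Reasoning

sumSym-summand-widen : ∀ N {K c} → K ℕ.≤ c → sumSym c (summand N (+ K)) ≋ sumSym K (summand N (+ K))
sumSym-summand-widen N K≤c = widen (ℕₚ.≤⇒≤′ K≤c)
  where
  widen : ∀ {K c} → K ℕ.≤′ c → sumSym c (summand N (+ K)) ≋ sumSym K (summand N (+ K))
  widen ℕ.≤′-refl = ≋-refl
  widen {K} {suc c} (ℕ.≤′-step K≤′c) =
    ≋-trans (sumSym-suc c (summand N (+ K)) (summand-vanishes-below N (ℕₚ.≤′⇒≤ K≤′c))
                                            (summand-vanishes-above N (ℕₚ.≤′⇒≤ K≤′c)))
            (widen K≤′c)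

sumSym-defect : ∀ c N K → sumSym c (defect N K) ≋
  (((qpowℤ (K ℤ.+ K) *ₚ sumSym c (summand N K)) +ₚ (-ₚ (qpowℤ (K ℤ.+ K) *ₚ sumSym c (summand (N ℤ.- + 1) K))))
   +ₚ (-ₚ (qpowℤ N *ₚ sumSym c (summand (N ℤ.- + 2) (K ℤ.- + 1)))))
sumSym-defect c N K = begin
  sumSym c (defect N K)
    ≈⟨ ∑-− L (λ t → (Q *ₚ S₀ t) +ₚ (-ₚ (Q *ₚ S₁ t))) (λ t → Qₙ *ₚ S₂ t) ⟩
  ∑[< L ] (λ t → (Q *ₚ S₀ t) +ₚ (-ₚ (Q *ₚ S₁ t))) +ₚ (-ₚ ∑[< L ] (λ t → Qₙ *ₚ S₂ t))
    ≈⟨ +-cong (∑-− L (λ t → Q *ₚ S₀ t) (λ t → Q *ₚ S₁ t)) (-‿cong (∑-*ˡ L Qₙ S₂)) ⟩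
  (∑[< L ] (λ t → Q *ₚ S₀ t) +ₚ (-ₚ ∑[< L ] (λ t → Q *ₚ S₁ t))) +ₚ (-ₚ (Qₙ *ₚ ∑[< L ] S₂))
    ≈⟨ +-congʳ {x = -ₚ (Qₙ *ₚ ∑[< L ] S₂)} (+-cong (∑-*ˡ L Q S₀) (-‿cong (∑-*ˡ L Q S₁))) ⟩
  ((Q *ₚ ∑[< L ] S₀) +ₚ (-ₚ (Q *ₚ ∑[< L ] S₁))) +ₚ (-ₚ (Qₙ *ₚ ∑[< L ] S₂)) ∎
  where
  open ≋-Reasoning
  L = suc (2 ℕ.* c)
  Q = qpowℤ (K ℤ.+ K)
  Qₙ = qpowℤ N
  S₀ S₁ S₂ : ℕ → PS
  S₀ t = summand N K (+ t ℤ.- + c)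
  S₁ t = summand (N ℤ.- + 1) K (+ t ℤ.- + c)
  S₂ t = summand (N ℤ.- + 2) (K ℤ.- + 1) (+ t ℤ.- + c)

LHS-recurrence : ∀ n k →
  (qpow (suc k ℕ.+ suc k) *ₚ LHS (suc (suc n)) (suc k)) ≋
  ((qpow (suc k ℕ.+ suc k) *ₚ LHS (suc n) (suc k)) +ₚ (qpow (suc (suc n)) *ₚ LHS n k))
LHS-recurrence n k = difference-vanishes (begin
  ((Q *ₚ LHS (suc (suc n)) (suc k)) +ₚ (-ₚ (Q *ₚ LHS (suc n) (suc k)))) +ₚ (-ₚ (Qₙ *ₚ LHS n k))
    ≈⟨ +-cong (+-cong (*-congˡ {x = Q} (sumSym-summand-widen N (ℕₚ.n≤1+n (suc k))))
                      (-‿cong (*-congˡ {x = Q} (sumSym-summand-widen (+ suc n) (ℕₚ.n≤1+n (suc k))))))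
              (-‿cong (*-congˡ {x = Qₙ} (sumSym-summand-widen (+ n) (ℕₚ.m≤n⇒m≤1+n (ℕₚ.n≤1+n k))))) ⟨
  ((Q *ₚ sumSym c (summand N K)) +ₚ (-ₚ (Q *ₚ sumSym c (summand (+ suc n) K))))
    +ₚ (-ₚ (Qₙ *ₚ sumSym c (summand (+ n) (+ k))))
    ≈⟨ sumSym-defect c N K ⟨
  sumSym c (defect N K)
    ≈⟨ sumSym-vanishes c
         (defect-vanishes N K -[1+ suc k ] (summand-vanishes-below N (ℕₚ.≤-refl {suc k}))
            (summand-vanishes-below (+ suc n) (ℕₚ.≤-refl {suc k})) (summand-vanishes-below (+ n) (ℕₚ.n≤1+n k)))
         (defect-vanishes N K (+ suc c) (summand-vanishes-above N (ℕₚ.n≤1+n (suc k)))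
            (summand-vanishes-above (+ suc n) (ℕₚ.n≤1+n (suc k)))
            (summand-vanishes-above (+ n) (ℕₚ.m≤n⇒m≤1+n (ℕₚ.n≤1+n k)))) ⟩
  0ₚ ∎)
  where
  open ≋-Reasoning
  N = + suc (suc n)
  K = + suc k
  c = suc (suc k)
  Q = qpow (suc k ℕ.+ suc k)
  Qₙ = qpow (suc (suc n))
  pair : ∀ j h → N ℤ.+ j ≡ h ℤ.+ h → (defect N K j +ₚ defect N K (j ℤ.+ + 1)) ≋ 0ₚ
  pair j h N+j≡2h = subst₂ (λ N′ j′ → (defect N′ K j′ +ₚ defect N′ K (j′ ℤ.+ + 1)) ≋ 0ₚ) h+[N-h]≡N j≡
    (defect-pairing h (N ℤ.- h) K (n ℕ.+ suc k) (cong (ℤ._+ K) h+[N-h]≡N))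
    where
    h+[N-h]≡N : h ℤ.+ (N ℤ.- h) ≡ N
    h+[N-h]≡N = cancel N h
      where
      cancel : ∀ N h → h ℤ.+ (N ℤ.- h) ≡ N
      cancel = ℤ-solve-∀
    j≡ : h ℤ.- (N ℤ.- h) ≡ j
    j≡ = halves-difference N j h N+j≡2h
  open PairwiseCancellation N (defect N K) pair

RHS-recurrence : ∀ n k →
  (qpow (suc k ℕ.+ suc k) *ₚ RHS (suc (suc n)) (suc k)) ≋
  ((qpow (suc k ℕ.+ suc k) *ₚ RHS (suc n) (suc k)) +ₚ (qpow (suc (suc n)) *ₚ RHS n k))
RHS-recurrence n k = begin
  Q₂ *ₚ qbinom α (+ suc k)
    ≈⟨ *-congʳ {x = qbinom α (+ suc k)} (qpow-+ (suc k) (suc k)) ⟨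
  (Q *ₚ Q) *ₚ qbinom α (+ suc k)
    ≈⟨ *-assoc Q Q (qbinom α (+ suc k)) ⟩
  Q *ₚ (Q *ₚ qbinom α (+ suc k))
    ≈⟨ *-congˡ {x = Q} (qbinom-pascal α (+ suc k) (λ ())) ⟩
  Q *ₚ ((Q *ₚ B′ (+ suc k)) +ₚ (qpowℤ α *ₚ B′ (+ k)))
    ≈⟨ distribˡ Q (Q *ₚ B′ (+ suc k)) (qpowℤ α *ₚ B′ (+ k)) ⟩
  (Q *ₚ (Q *ₚ B′ (+ suc k))) +ₚ (Q *ₚ (qpowℤ α *ₚ B′ (+ k)))
    ≈⟨ +-cong (≋-trans (≋-sym (*-assoc Q Q (B′ (+ suc k))))
                       (*-congʳ {x = B′ (+ suc k)} (qpow-+ (suc k) (suc k))))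
              (qpow-qpowℤ-absorb (suc k) α (qbinom-pred-negˡ (+ k))) ⟩
  (Q₂ *ₚ B′ (+ suc k)) +ₚ (qpowℤ (+ suc k ℤ.+ α) *ₚ B′ (+ k))
    ≡⟨ cong₂ _+ₚ_ (cong (λ x → Q₂ *ₚ qbinom x (+ suc k)) α-1≡)
                  (cong₂ (λ e x → qpowℤ e *ₚ qbinom x (+ k)) k+α≡ α-1≡′) ⟩
  (Q₂ *ₚ RHS (suc n) (suc k)) +ₚ (qpow (suc (suc n)) *ₚ RHS n k) ∎
  where
  open ≋-Reasoning
  Q = qpow (suc k)
  Q₂ = qpow (suc k ℕ.+ suc k)
  α = + suc (suc n) ℤ.- + suc k
  B′ = qbinom (α ℤ.- + 1)
  shift : ∀ N K → (+ 1 ℤ.+ N) ℤ.- (+ 1 ℤ.+ K) ℤ.- + 1 ≡ N ℤ.- (+ 1 ℤ.+ K)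
  shift = ℤ-solve-∀
  α-1≡ : α ℤ.- + 1 ≡ + suc n ℤ.- + suc k
  α-1≡ = shift (+ suc n) (+ k)
  shift′ : ∀ N K → (+ 2 ℤ.+ N) ℤ.- (+ 1 ℤ.+ K) ℤ.- + 1 ≡ N ℤ.- K
  shift′ = ℤ-solve-∀
  α-1≡′ : α ℤ.- + 1 ≡ + n ℤ.- + k
  α-1≡′ = shift′ (+ n) (+ k)
  absorb : ∀ N K → (+ 1 ℤ.+ K) ℤ.+ ((+ 2 ℤ.+ N) ℤ.- (+ 1 ℤ.+ K)) ≡ + 2 ℤ.+ N
  absorb = ℤ-solve-∀
  k+α≡ : + suc k ℤ.+ α ≡ + suc (suc n)
  k+α≡ = absorb (+ n) (+ k)

LHS-vanishes : ∀ {n k} → n ℕ.< k ℕ.+ k → LHS n k ≋ 0ₚ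
LHS-vanishes {n} {k} n<2k =
  ∑-0 (suc (2 ℕ.* k)) (λ t → summand (+ n) (+ k) (+ t ℤ.- + k))
      (λ t → summand-vanishes-small {n} {k} n<2k (+ t ℤ.- + k))

RHS-vanishes : ∀ {n k} → n ℕ.< k ℕ.+ k → RHS n k ≋ 0ₚ
RHS-vanishes {n} {k} n<2k =
  qbinom-below (subst (+ n ℤ.- + k ℤ.<_) 2k-k≡k (ℤₚ.+-monoˡ-< (ℤ.- + k) (ℤ.+<+ n<2k)))
  where
  cancel : ∀ K → K ℤ.+ K ℤ.- K ≡ K
  cancel = ℤ-solve-∀
  2k-k≡k : + (k ℕ.+ k) ℤ.- + k ≡ + k
  2k-k≡k = trans (cong (ℤ._- + k) (ℤₚ.pos-+ k k)) (cancel (+ k))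

LHS≋RHS-n<2k : ∀ {n k} → n ℕ.< k ℕ.+ k → LHS n k ≋ RHS n k
LHS≋RHS-n<2k {n} {k} n<2k = ≋-trans (LHS-vanishes {n} {k} n<2k) (≋-sym (RHS-vanishes {n} {k} n<2k))

-- LHS n 0 computes to its single term j = 0.
LHS≋RHS-k≡0 : ∀ n → LHS n 0 ≋ RHS n 0
LHS≋RHS-k≡0 n = begin
  ((+ 1) ·ₚ (1ₚ *ₚ (1ₚ *ₚ 1ₚ))) +ₚ 0ₚ   ≈⟨ +-identityʳ ((+ 1) ·ₚ (1ₚ *ₚ (1ₚ *ₚ 1ₚ))) ⟩
  (+ 1) ·ₚ (1ₚ *ₚ (1ₚ *ₚ 1ₚ))           ≈⟨ coeffwise (λ M → ℤₚ.*-identityˡ ((1ₚ *ₚ (1ₚ *ₚ 1ₚ)) M)) ⟩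
  1ₚ *ₚ (1ₚ *ₚ 1ₚ)                      ≈⟨ ≋-trans (*-identityˡ (1ₚ *ₚ 1ₚ)) (*-identityˡ 1ₚ) ⟩
  1ₚ                                     ∎
  where open ≋-Reasoning

theorem2 : (n k : ℕ) → LHS n k ≈ₚ RHS n k
theorem2 n zero = coeff (LHS≋RHS-k≡0 n)
theorem2 zero (suc k) = coeff (LHS≋RHS-n<2k {0} {suc k} (s≤s z≤n))
theorem2 (suc zero) (suc k) =
  coeff (LHS≋RHS-n<2k {1} {suc k} (s≤s (ℕₚ.≤-trans (s≤s z≤n) (ℕₚ.m≤n+m (suc k) k))))
theorem2 (suc (suc n)) (suc k) = coeff (qpow-cancelˡ (suc k ℕ.+ suc k) (begin
  Q *ₚ LHS (suc (suc n)) (suc k)                           ≈⟨ LHS-recurrence n k ⟩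
  (Q *ₚ LHS (suc n) (suc k)) +ₚ (qpow (suc (suc n)) *ₚ LHS n k)
    ≈⟨ +-cong (*-congˡ {x = Q} (coeffwise (theorem2 (suc n) (suc k))))
              (*-congˡ {x = qpow (suc (suc n))} (coeffwise (theorem2 n k))) ⟩
  (Q *ₚ RHS (suc n) (suc k)) +ₚ (qpow (suc (suc n)) *ₚ RHS n k) ≈⟨ RHS-recurrence n k ⟨
  Q *ₚ RHS (suc (suc n)) (suc k)                           ∎))
  where
  open ≋-Reasoning
  Q = qpow (suc k ℕ.+ suc k)
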